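{- Let $G$ be a permutation group on a finite set $\Omega$ of size $n$ which contains odd permutations, and let $N$ be the subgroup of even permutations in $G$. Then for every positive integer $a$, \[0\le(-1)^nF_G(-a)<F_G(a),\] and $(-1)^nF_G(-a)=0$ if and only if $G$ and $N$ have the same number of orbits on colourings of $\Omega$ with $a$ colours (i.e. on functions $\Omega\to\{1,\dots,a\}$).
   Context: $F_G(x)=\sum_{g\in G}x^{c(g)}$, where $c(g)$ is the number of cycles of $g$ on $\Omega$ (including fixed points). $G$ acts on colourings $f:\Omega\to\{1,\dots,a\}$ by permuting $\Omega$. -}

module Defs where

open import Data.Bool using (Bool; true; false; if_then_else_; not; _∧_; _∨_)
open import Data.Nat as ℕ using (ℕ; zero; suc; _+_; _%_)
open import Data.Fin using (Fin; zero; suc; toℕ)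
open import Data.Fin.Permutation using (Permutation′; _⟨$⟩ʳ_; _⟨$⟩ˡ_)
open import Data.List using (List; []; _∷_; [_]; map; concatMap; filterᵇ; allFin; foldr)
open import Data.List.Membership.Propositional using (_∈_)
open import Data.List.Relation.Unary.Any using (Any)
open import Data.List.Relation.Unary.AllPairs using (AllPairs)
open import Data.Integer as ℤ using (ℤ)
open import Relation.Binary.PropositionalEquality using (_≡_)
open import Relation.Nullary using (¬_; ⌊_⌋)
open import Function using (_∘_)

anyFin : ∀ {n} → (Fin n → Bool) → Bool
anyFin {zero} p = false
anyFin {suc n} p = p zero ∨ anyFin (p ∘ suc)

allFin? : ∀ {n} → (Fin n → Bool) → Bool
allFin? p = not (anyFin (not ∘ p))

countFin : ∀ {n} → (Fin n → Bool) → ℕ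
countFin {zero} p = 0
countFin {suc n} p = (if p zero then 1 else 0) + countFin (p ∘ suc)

sumFin : ∀ {n} → (Fin n → ℕ) → ℕ
sumFin {zero} f = 0
sumFin {suc n} f = f zero + sumFin (f ∘ suc)

anyList : ∀ {A : Set} → (A → Bool) → List A → Bool
anyList p = foldr (λ x b → p x ∨ b) false

module _ {n : ℕ} where

  _≈ₚ_ : Permutation′ n → Permutation′ n → Set
  g ≈ₚ h = ∀ i → g ⟨$⟩ʳ i ≡ h ⟨$⟩ʳ i

  iter : Permutation′ n → ℕ → Fin n → Fin n
  iter g zero i = i
  iter g (suc k) i = g ⟨$⟩ʳ iter g k i

  -- c(g): number of cycles of g (fixed points included), counted by
  -- the least element of each cycle: i is counted iff no g^k i (k < n)
  -- is smaller than i.  (Every cycle has length ≤ n.)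
  cycles : Permutation′ n → ℕ
  cycles g = countFin {n} λ i →
    not (anyFin {n} λ k → ⌊ toℕ (iter g (toℕ k) i) ℕ.<? toℕ i ⌋)

  inversions : Permutation′ n → ℕ
  inversions g = sumFin {n} λ i → countFin {n} λ j →
    ⌊ toℕ i ℕ.<? toℕ j ⌋ ∧ ⌊ toℕ (g ⟨$⟩ʳ j) ℕ.<? toℕ (g ⟨$⟩ʳ i) ⌋

  isEven : Permutation′ n → Bool
  isEven g = ⌊ inversions g % 2 ℕ.≟ 0 ⌋

  record IsPermGroup (G : List (Permutation′ n)) : Set where
    field
      distinct : AllPairs (λ g h → ¬ (g ≈ₚ h)) G
      hasId    : Any (λ e → ∀ i → e ⟨$⟩ʳ i ≡ i) G
      closed   : ∀ {g h} → g ∈ G → h ∈ G →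
                 Any (λ k → ∀ i → k ⟨$⟩ʳ i ≡ g ⟨$⟩ʳ (h ⟨$⟩ʳ i)) G
      inverses : ∀ {g} → g ∈ G → Any (λ k → ∀ i → k ⟨$⟩ʳ i ≡ g ⟨$⟩ˡ i) G

  evenPart : List (Permutation′ n) → List (Permutation′ n)
  evenPart = filterᵇ isEven

  cycleIndexPoly : List (Permutation′ n) → ℤ → ℤ
  cycleIndexPoly G x = foldr (λ g s → x ℤ.^ cycles g ℤ.+ s) (ℤ.+ 0) G

cons : ∀ {n a} → Fin a → (Fin n → Fin a) → Fin (suc n) → Fin a
cons c f zero = c
cons c f (suc i) = f i

allColourings : (n a : ℕ) → List (Fin n → Fin a)
allColourings zero a = [ (λ ()) ]
allColourings (suc n) a =
  concatMap (λ c → map (cons c) (allColourings n a)) (allFin a)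

module _ {n a : ℕ} where

  sameOrbit : List (Permutation′ n) → (Fin n → Fin a) → (Fin n → Fin a) → Bool
  sameOrbit G f f' = anyList (λ h → allFin? {n} λ i → ⌊ f (h ⟨$⟩ʳ i) Data.Fin.≟ f' i ⌋) G

  countNew : List (Permutation′ n) → List (Fin n → Fin a) → List (Fin n → Fin a) → ℕ
  countNew G seen [] = 0
  countNew G seen (f ∷ fs) =
    (if anyList (λ f' → sameOrbit G f' f) seen then 0 else 1) + countNew G (f ∷ seen) fs

orbitCount : ∀ {n} → List (Permutation′ n) → (a : ℕ) → ℕ
orbitCount {n} G a = countNew {n} {a} G [] (allColourings n a)

-- Write ε(g) for the sign and c(g) for the number of cycles of g. Since ε(g) = (-1)^(n - c(g)) and
-- exactly a^c(g) colourings are fixed by g, counting pairs (g, f) with f ∘ g = f gives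
--   (-1)ⁿ F_G(-a) = Σ_g ε(g) a^c(g) = Σ_f Σ_{g ∈ Stab f} ε(g).
-- The inner sum is 0 if Stab f contains an odd t (right translation by t swaps its even and odd
-- elements) and |Stab f| > 0 otherwise. Hence (-1)ⁿ F_G(-a) ≥ 0, it is below F_G(a) = Σ_g a^c(g)
-- because G has odd elements, and it vanishes iff every colouring has an odd symmetry, which is
-- exactly when G and its even part N have the same orbits on colourings (N-orbits refine G-orbits,
-- so the orbit counts agree exactly when the orbits do). The two facts about a single permutation
-- are proved by induction on n, splitting g into a permutation fixing the last point and a
-- transposition with it.

module Submission where

open import Defs

module CycleCount where

  open import Data.Bool using (Bool; true; false; if_then_else_; not; _∧_; _∨_; _xor_)
  open import Data.Bool.Properties
    using (⇔→≡; ∧-conicalˡ; ∧-conicalʳ; ∧-identityʳ; not-involutive; not-distribˡ-xor; xor-same; xor-identityʳ; xor-comm)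
  open import Data.Nat as ℕ using (ℕ; zero; suc; _+_; _*_; _∸_; _%_; _/_; _^_; _≤_; _<_; _<?_)
  import Data.Nat.Properties as ℕₚ
  open import Data.Nat.DivMod using ([m+n]%n≡m%n; m≡m%n+[m/n]*n; m%n<n)
  open import Data.Fin as Fin using (Fin; zero; suc; toℕ; fromℕ; fromℕ<; inject₁; lower₁)
  import Data.Fin.Properties as Finₚ
  open import Data.Fin.Permutation as Perm using (Permutation′; _⟨$⟩ʳ_; _⟨$⟩ˡ_; _∘ₚ_)
  import Data.Fin.Permutation.Components as PC
  open import Data.List using (List; []; _∷_; _++_; map; concatMap; allFin; tabulate; foldr)
  open import Data.List.Relation.Unary.Any as Any using (Any; here; there)
  open import Data.List.Relation.Unary.All as All using (All; []; _∷_)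
  open import Data.Product using (∃; _×_; _,_)
  open import Data.Sum using (_⊎_; inj₁; inj₂)
  open import Function using (_∘_; id)
  open import Function.Bundles using (mk⇔)
  open import Relation.Binary.PropositionalEquality
    using (_≡_; _≢_; refl; sym; trans; cong; cong₂; subst; subst₂; module ≡-Reasoning)
  open import Relation.Nullary using (¬_; Dec; yes; no; ⌊_⌋; contradiction)
  open import Relation.Nullary.Decidable using (dec-true; dec-false)
  import Algebra.Properties.CommutativeMonoid.Sum as CommutativeMonoidSum
  open import Algebra.Bundles using (CommutativeMonoid)
  open import Level using (0ℓ)

  ⌊⌋-yes : ∀ {P : Set} (d : Dec P) → P → ⌊ d ⌋ ≡ true
  ⌊⌋-yes (yes _) _ = refl
  ⌊⌋-yes (no ¬p) p = contradiction p ¬p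

  ⌊⌋-no : ∀ {P : Set} (d : Dec P) → ¬ P → ⌊ d ⌋ ≡ false
  ⌊⌋-no (yes p) ¬p = contradiction p ¬p
  ⌊⌋-no (no _)  _  = refl

  ⌊⌋-yes⁻ : ∀ {P : Set} (d : Dec P) → ⌊ d ⌋ ≡ true → P
  ⌊⌋-yes⁻ (yes p) _ = p

  anyFin⁺ : ∀ {n} (p : Fin n → Bool) (i : Fin n) → p i ≡ true → anyFin p ≡ true
  anyFin⁺ p zero pi rewrite pi = refl
  anyFin⁺ p (suc i) pi with p zero
  ... | true  = refl
  ... | false = anyFin⁺ (p ∘ suc) i pi

  anyFin⁻ : ∀ {n} (p : Fin n → Bool) → anyFin p ≡ true → ∃ λ i → p i ≡ true
  anyFin⁻ {suc n} p any with p zero in p0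
  ... | true  = zero , p0
  ... | false = let i , pi = anyFin⁻ (p ∘ suc) any in suc i , pi

  anyFin-cong : ∀ {n} {p q : Fin n → Bool} → (∀ i → p i ≡ q i) → anyFin p ≡ anyFin q
  anyFin-cong {zero}  p≗q = refl
  anyFin-cong {suc n} p≗q = cong₂ _∨_ (p≗q zero) (anyFin-cong (p≗q ∘ suc))

  anyFin-false : ∀ {n} → anyFin {n} (λ _ → false) ≡ false
  anyFin-false {zero}  = refl
  anyFin-false {suc n} = anyFin-false {n}

  allFin?⁺ : ∀ {n} (p : Fin n → Bool) → (∀ i → p i ≡ true) → allFin? p ≡ true
  allFin?⁺ {n} p all = cong not (trans (anyFin-cong (λ i → cong not (all i))) (anyFin-false {n}))

  allFin?⁻ : ∀ {n} (p : Fin n → Bool) → allFin? p ≡ true → ∀ i → p i ≡ true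
  allFin?⁻ p all i with p i in pi
  ... | true  = refl
  ... | false = contradiction (trans (sym all) (cong not (anyFin⁺ (not ∘ p) i (cong not pi)))) λ ()

  allFin?-cong : ∀ {n} {p q : Fin n → Bool} → (∀ i → p i ≡ q i) → allFin? p ≡ allFin? q
  allFin?-cong p≗q = cong not (anyFin-cong (cong not ∘ p≗q))

  module _ {n a : ℕ} {u v : Fin n → Fin a} where

    allFin?-≡⁺ : (∀ i → u i ≡ v i) → allFin? (λ i → ⌊ u i Fin.≟ v i ⌋) ≡ true
    allFin?-≡⁺ u≗v = allFin?⁺ _ (λ i → ⌊⌋-yes (u i Fin.≟ v i) (u≗v i))

    allFin?-≡⁻ : allFin? (λ i → ⌊ u i Fin.≟ v i ⌋) ≡ true → ∀ i → u i ≡ v i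
    allFin?-≡⁻ all i = ⌊⌋-yes⁻ (u i Fin.≟ v i) (allFin?⁻ _ all i)

  anyList⁺ : ∀ {A : Set} (p : A → Bool) {xs : List A} → Any (λ x → p x ≡ true) xs → anyList p xs ≡ true
  anyList⁺ p (here px) rewrite px = refl
  anyList⁺ p {x ∷ _} (there any) with p x
  ... | true  = refl
  ... | false = anyList⁺ p any

  anyList⁻ : ∀ {A : Set} (p : A → Bool) (xs : List A) → anyList p xs ≡ true → Any (λ x → p x ≡ true) xs
  anyList⁻ p (x ∷ xs) any with p x in px
  ... | true  = here px
  ... | false = there (anyList⁻ p xs any)

  anyList-false⁻ : ∀ {A : Set} (p : A → Bool) (xs : List A) → anyList p xs ≡ false → All (λ x → p x ≡ false) xs
  anyList-false⁻ p []       _    = []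
  anyList-false⁻ p (x ∷ xs) none with p x in px
  ... | false = px ∷ anyList-false⁻ p xs none

  anyList-cong : ∀ {A : Set} {p q : A → Bool} (xs : List A) → (∀ x → p x ≡ q x) → anyList p xs ≡ anyList q xs
  anyList-cong []       p≗q = refl
  anyList-cong (x ∷ xs) p≗q = cong₂ _∨_ (p≗q x) (anyList-cong xs p≗q)

  𝟙 : Bool → ℕ
  𝟙 b = if b then 1 else 0

  sumFin-cong : ∀ {n} {f g : Fin n → ℕ} → (∀ i → f i ≡ g i) → sumFin f ≡ sumFin g
  sumFin-cong {zero}  f≗g = refl
  sumFin-cong {suc n} f≗g = cong₂ _+_ (f≗g zero) (sumFin-cong (f≗g ∘ suc))

  countFin≡sumFin : ∀ {n} (p : Fin n → Bool) → countFin p ≡ sumFin (𝟙 ∘ p)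
  countFin≡sumFin {zero}  p = refl
  countFin≡sumFin {suc n} p = cong (𝟙 (p zero) +_) (countFin≡sumFin (p ∘ suc))

  countFin-cong : ∀ {n} {p q : Fin n → Bool} → (∀ i → p i ≡ q i) → countFin p ≡ countFin q
  countFin-cong {zero}  p≗q = refl
  countFin-cong {suc n} p≗q = cong₂ _+_ (cong 𝟙 (p≗q zero)) (countFin-cong (p≗q ∘ suc))

  sumFin-zero : ∀ {n} (f : Fin n → ℕ) → (∀ i → f i ≡ 0) → sumFin f ≡ 0
  sumFin-zero {zero}  f f≗0 = refl
  sumFin-zero {suc n} f f≗0 rewrite f≗0 zero = sumFin-zero (f ∘ suc) (f≗0 ∘ suc)

  countFin-zero : ∀ {n} (p : Fin n → Bool) → (∀ i → p i ≡ false) → countFin p ≡ 0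
  countFin-zero p ¬p = trans (countFin≡sumFin p) (sumFin-zero _ (cong 𝟙 ∘ ¬p))

  sumFin-single : ∀ {n} (f : Fin n → ℕ) (k : Fin n) → (∀ i → i ≢ k → f i ≡ 0) → sumFin f ≡ f k
  sumFin-single f zero    f≗0 =
    trans (cong (f zero +_) (sumFin-zero (f ∘ suc) (λ i → f≗0 (suc i) λ ()))) (ℕₚ.+-identityʳ _)
  sumFin-single f (suc k) f≗0 rewrite f≗0 zero (λ ()) =
    sumFin-single (f ∘ suc) k (λ i i≢k → f≗0 (suc i) (i≢k ∘ Finₚ.suc-injective))

  sumFin-const : ∀ n (k : ℕ) → sumFin {n} (λ _ → k) ≡ n * k
  sumFin-const zero    k = refl
  sumFin-const (suc n) k = cong (k +_) (sumFin-const n k)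

  sumFin-double : ∀ {n} (f : Fin n → ℕ) → sumFin (λ i → 2 * f i) ≡ 2 * sumFin f
  sumFin-double {zero}  f = refl
  sumFin-double {suc n} f =
    trans (cong (2 * f zero +_) (sumFin-double (f ∘ suc))) (sym (ℕₚ.*-distribˡ-+ 2 (f zero) _))

  module _ where
    open CommutativeMonoidSum ℕₚ.+-0-commutativeMonoid using (sum; ∑-distrib-+; ∑-comm; sum-permute; sum-init-last)

    sumFin≡sum : ∀ {n} (f : Fin n → ℕ) → sumFin f ≡ sum f
    sumFin≡sum {zero}  f = refl
    sumFin≡sum {suc n} f = cong (f zero +_) (sumFin≡sum (f ∘ suc))

    sumFin-+ : ∀ {n} (f g : Fin n → ℕ) → sumFin (λ i → f i + g i) ≡ sumFin f + sumFin g
    sumFin-+ f g = trans (sumFin≡sum (λ i → f i + g i))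
      (trans (∑-distrib-+ f g) (sym (cong₂ _+_ (sumFin≡sum f) (sumFin≡sum g))))

    sumFin-swap : ∀ {m n} (f : Fin m → Fin n → ℕ) →
      sumFin (λ i → sumFin (f i)) ≡ sumFin (λ j → sumFin (λ i → f i j))
    sumFin-swap f = begin
      sumFin (λ i → sumFin (f i))        ≡⟨ sumFin-cong (λ i → sumFin≡sum (f i)) ⟩
      sumFin (λ i → sum (f i))           ≡⟨ sumFin≡sum (λ i → sum (f i)) ⟩
      sum (λ i → sum (f i))              ≡⟨ ∑-comm f ⟩
      sum (λ j → sum (λ i → f i j))      ≡⟨ sumFin≡sum (λ j → sum (λ i → f i j)) ⟨
      sumFin (λ j → sum (λ i → f i j))   ≡⟨ sumFin-cong (λ j → sumFin≡sum (λ i → f i j)) ⟨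
      sumFin (λ j → sumFin (λ i → f i j)) ∎
      where open ≡-Reasoning

    sumFin-permute : ∀ {n} (f : Fin n → ℕ) (π : Permutation′ n) → sumFin (f ∘ (π ⟨$⟩ʳ_)) ≡ sumFin f
    sumFin-permute f π =
      trans (sumFin≡sum (f ∘ (π ⟨$⟩ʳ_))) (trans (sym (sum-permute f π)) (sym (sumFin≡sum f)))

    sumFin-init-last : ∀ {n} (f : Fin (suc n) → ℕ) → sumFin f ≡ sumFin (f ∘ inject₁) + f (fromℕ n)
    sumFin-init-last {n} f = trans (sumFin≡sum f)
      (trans (sum-init-last f) (cong (_+ f (fromℕ n)) (sym (sumFin≡sum (f ∘ inject₁)))))

  countFin-init-last : ∀ {n} (p : Fin (suc n) → Bool) → countFin p ≡ countFin (p ∘ inject₁) + 𝟙 (p (fromℕ n))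
  countFin-init-last {n} p = begin
    countFin p                                   ≡⟨ countFin≡sumFin p ⟩
    sumFin (𝟙 ∘ p)                               ≡⟨ sumFin-init-last (𝟙 ∘ p) ⟩
    sumFin (𝟙 ∘ p ∘ inject₁) + 𝟙 (p (fromℕ n))   ≡⟨ cong (_+ 𝟙 (p (fromℕ n))) (countFin≡sumFin (p ∘ inject₁)) ⟨
    countFin (p ∘ inject₁) + 𝟙 (p (fromℕ n))     ∎
    where open ≡-Reasoning

  ΣΣ : ∀ {n} → (Fin n → Fin n → ℕ) → ℕ
  ΣΣ f = sumFin (λ i → sumFin (f i))

  ΣΣ-cong : ∀ {n} {f g : Fin n → Fin n → ℕ} → (∀ i j → f i j ≡ g i j) → ΣΣ f ≡ ΣΣ g
  ΣΣ-cong f≗g = sumFin-cong (λ i → sumFin-cong (f≗g i))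

  ΣΣ-+ : ∀ {n} (f g : Fin n → Fin n → ℕ) → ΣΣ (λ i j → f i j + g i j) ≡ ΣΣ f + ΣΣ g
  ΣΣ-+ f g = trans (sumFin-cong (λ i → sumFin-+ (f i) (g i))) (sumFin-+ (sumFin ∘ f) (sumFin ∘ g))

  toℕ-inject₁<n : ∀ {n} (x : Fin n) → toℕ (inject₁ x) < n
  toℕ-inject₁<n x rewrite Finₚ.toℕ-inject₁ x = Finₚ.toℕ<n x

  toℕ<n-of≢fromℕ : ∀ {n} {y : Fin (suc n)} → y ≢ fromℕ n → toℕ y < n
  toℕ<n-of≢fromℕ {n} {y} y≢L = ℕₚ.≤∧≢⇒< (ℕₚ.≤-pred (Finₚ.toℕ<n y))
    (λ y≡n → y≢L (Finₚ.toℕ-injective (trans y≡n (sym (Finₚ.toℕ-fromℕ n)))))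

  last-or-inject₁ : ∀ {n} (y : Fin (suc n)) → y ≡ fromℕ n ⊎ ∃ λ x → y ≡ inject₁ x
  last-or-inject₁ {n} y with y Fin.≟ fromℕ n
  ... | yes y≡L = inj₁ y≡L
  ... | no y≢L  = inj₂ (lower₁ y n≢y , sym (Finₚ.inject₁-lower₁ y n≢y))
    where
    n≢y : n ≢ toℕ y
    n≢y n≡y = ℕₚ.<-irrefl (sym n≡y) (toℕ<n-of≢fromℕ y≢L)

  module ListSum (M : CommutativeMonoid 0ℓ 0ℓ) where
    open CommutativeMonoid M
      using (Carrier; _≈_; _∙_; ε; ∙-cong; ∙-congˡ; identityˡ; assoc; commutativeSemigroup)
      renaming (refl to ≈-refl; sym to ≈-sym; trans to ≈-trans)
    open import Algebra.Properties.CommutativeSemigroup commutativeSemigroup using (interchange)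

    sum : ∀ {A : Set} → List A → (A → Carrier) → Carrier
    sum xs φ = foldr (λ x s → φ x ∙ s) ε xs

    sum-cong : ∀ {A : Set} (xs : List A) {φ ψ : A → Carrier} → (∀ x → φ x ≈ ψ x) → sum xs φ ≈ sum xs ψ
    sum-cong []       φ≈ψ = ≈-refl
    sum-cong (x ∷ xs) φ≈ψ = ∙-cong (φ≈ψ x) (sum-cong xs φ≈ψ)

    sum-cong-∈ : ∀ {A : Set} {xs : List A} {φ ψ : A → Carrier} → All (λ x → φ x ≈ ψ x) xs → sum xs φ ≈ sum xs ψ
    sum-cong-∈ []           = ≈-refl
    sum-cong-∈ (φ≈ψ ∷ rest) = ∙-cong φ≈ψ (sum-cong-∈ rest)

    sum-++ : ∀ {A : Set} (xs ys : List A) (φ : A → Carrier) → sum (xs ++ ys) φ ≈ sum xs φ ∙ sum ys φ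
    sum-++ []       ys φ = ≈-sym (identityˡ _)
    sum-++ (x ∷ xs) ys φ = ≈-trans (∙-congˡ (sum-++ xs ys φ)) (≈-sym (assoc _ _ _))

    sum-map : ∀ {A B : Set} (h : A → B) (xs : List A) (φ : B → Carrier) → sum (map h xs) φ ≈ sum xs (φ ∘ h)
    sum-map h []       φ = ≈-refl
    sum-map h (x ∷ xs) φ = ∙-congˡ (sum-map h xs φ)

    sum-concatMap : ∀ {A B : Set} (h : A → List B) (xs : List A) (φ : B → Carrier) →
      sum (concatMap h xs) φ ≈ sum xs (λ x → sum (h x) φ)
    sum-concatMap h []       φ = ≈-refl
    sum-concatMap h (x ∷ xs) φ = ≈-trans (sum-++ (h x) (concatMap h xs) φ) (∙-congˡ (sum-concatMap h xs φ))

    sum-ε : ∀ {A : Set} (xs : List A) → sum xs (λ _ → ε) ≈ ε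
    sum-ε []       = ≈-refl
    sum-ε (x ∷ xs) = ≈-trans (identityˡ _) (sum-ε xs)

    sum-distrib : ∀ {A : Set} (xs : List A) (φ ψ : A → Carrier) → sum xs (λ x → φ x ∙ ψ x) ≈ sum xs φ ∙ sum xs ψ
    sum-distrib []       φ ψ = ≈-sym (identityˡ ε)
    sum-distrib (x ∷ xs) φ ψ = ≈-trans (∙-congˡ (sum-distrib xs φ ψ)) (interchange _ _ _ _)

    sum-swap : ∀ {A B : Set} (xs : List A) (ys : List B) (φ : A → B → Carrier) →
      sum xs (λ x → sum ys (φ x)) ≈ sum ys (λ y → sum xs (λ x → φ x y))
    sum-swap []       ys φ = ≈-sym (sum-ε ys)
    sum-swap (x ∷ xs) ys φ = ≈-trans (∙-congˡ (sum-swap xs ys φ)) (≈-sym (sum-distrib ys (φ x) _))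

  module ℕΣ = ListSum ℕₚ.+-0-commutativeMonoid

  countList : ∀ {A : Set} → (A → Bool) → List A → ℕ
  countList p xs = ℕΣ.sum xs (𝟙 ∘ p)

  sum-tabulate : ∀ {A : Set} {n} (h : Fin n → A) (φ : A → ℕ) → ℕΣ.sum (tabulate h) φ ≡ sumFin (φ ∘ h)
  sum-tabulate {n = zero}  h φ = refl
  sum-tabulate {n = suc n} h φ = cong (φ (h zero) +_) (sum-tabulate (h ∘ suc) φ)

  sum-allFin : ∀ {n} (φ : Fin n → ℕ) → ℕΣ.sum (allFin n) φ ≡ sumFin φ
  sum-allFin = sum-tabulate id

  sumFin-sum-swap : ∀ {A : Set} {k} (xs : List A) (φ : Fin k → A → ℕ) →
    sumFin (λ c → ℕΣ.sum xs (φ c)) ≡ ℕΣ.sum xs (λ x → sumFin (λ c → φ c x))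
  sumFin-sum-swap {k = k} xs φ = begin
    sumFin (λ c → ℕΣ.sum xs (φ c))                 ≡⟨ sum-allFin (λ c → ℕΣ.sum xs (φ c)) ⟨
    ℕΣ.sum (allFin k) (λ c → ℕΣ.sum xs (φ c))      ≡⟨ ℕΣ.sum-swap (allFin k) xs φ ⟩
    ℕΣ.sum xs (λ x → ℕΣ.sum (allFin k) (λ c → φ c x)) ≡⟨ ℕΣ.sum-cong xs (λ x → sum-allFin (λ c → φ c x)) ⟩
    ℕΣ.sum xs (λ x → sumFin (λ c → φ c x))         ∎
    where open ≡-Reasoning

  odd : ℕ → Bool
  odd zero    = false
  odd (suc m) = not (odd m)

  odd-+ : ∀ m n → odd (m + n) ≡ odd m xor odd n
  odd-+ zero    n = refl
  odd-+ (suc m) n = trans (cong not (odd-+ m n)) (not-distribˡ-xor (odd m) (odd n))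

  odd-double : ∀ m → odd (2 * m) ≡ false
  odd-double m rewrite odd-+ m (m + 0) | ℕₚ.+-identityʳ m = xor-same (odd m)

  %2≟0≡not-odd : ∀ m → ⌊ m % 2 ℕ.≟ 0 ⌋ ≡ not (odd m)
  %2≟0≡not-odd zero          = refl
  %2≟0≡not-odd (suc zero)    = refl
  %2≟0≡not-odd (suc (suc m)) = begin
    ⌊ (2 + m) % 2 ℕ.≟ 0 ⌋ ≡⟨ cong (λ r → ⌊ r ℕ.≟ 0 ⌋) (trans (cong (_% 2) (ℕₚ.+-comm 2 m)) ([m+n]%n≡m%n m 2)) ⟩
    ⌊ m % 2 ℕ.≟ 0 ⌋       ≡⟨ %2≟0≡not-odd m ⟩
    not (odd m)           ≡⟨ not-involutive (not (odd m)) ⟨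
    not (odd (2 + m))     ∎
    where open ≡-Reasoning

  -- Inversions and the sign of a permutation

  inversionsOf : ∀ {n} → (Fin n → ℕ) → ℕ
  inversionsOf v = sumFin λ i → countFin λ j → ⌊ toℕ i <? toℕ j ⌋ ∧ ⌊ v j <? v i ⌋

  oneLine : ∀ {n} → Permutation′ n → Fin n → ℕ
  oneLine g i = toℕ (g ⟨$⟩ʳ i)

  isEven≡not-odd : ∀ {n} (g : Permutation′ n) → isEven g ≡ not (odd (inversionsOf (oneLine g)))
  isEven≡not-odd g = %2≟0≡not-odd (inversions g)

  inversionsOf-cong : ∀ {n} {v w : Fin n → ℕ} → (∀ i → v i ≡ w i) → inversionsOf v ≡ inversionsOf w
  inversionsOf-cong v≗w = sumFin-cong λ i → countFin-cong λ j →
    cong₂ (λ x y → ⌊ toℕ i <? toℕ j ⌋ ∧ ⌊ x <? y ⌋) (v≗w j) (v≗w i)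

  isEven-cong : ∀ {n} {g h : Permutation′ n} → (∀ i → g ⟨$⟩ʳ i ≡ h ⟨$⟩ʳ i) → isEven g ≡ isEven h
  isEven-cong {g = g} {h} g≗h = begin
    isEven g                                  ≡⟨ isEven≡not-odd g ⟩
    not (odd (inversionsOf (oneLine g)))      ≡⟨ cong (not ∘ odd) (inversionsOf-cong (cong toℕ ∘ g≗h)) ⟩
    not (odd (inversionsOf (oneLine h)))      ≡⟨ isEven≡not-odd h ⟨
    isEven h                                  ∎
    where open ≡-Reasoning

  <?-flip : ∀ {a b} → a ≢ b → ⌊ a <? b ⌋ ≡ not ⌊ b <? a ⌋
  <?-flip {a} {b} a≢b with a <? b | b <? a
  ... | yes a<b | yes b<a = contradiction b<a (ℕₚ.<-asym a<b)
  ... | yes _   | no _    = refl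
  ... | no _    | yes _   = refl
  ... | no a≮b  | no b≮a  = contradiction (ℕₚ.≤-antisym (ℕₚ.≮⇒≥ b≮a) (ℕₚ.≮⇒≥ a≮b)) a≢b

  𝟙-split-< : ∀ a b (w : Bool) → (a ≡ b → w ≡ false) → 𝟙 w ≡ 𝟙 (⌊ a <? b ⌋ ∧ w) + 𝟙 (⌊ b <? a ⌋ ∧ w)
  𝟙-split-< a b w diag with a <? b | b <? a
  ... | yes a<b | yes b<a = contradiction b<a (ℕₚ.<-asym a<b)
  ... | yes _   | no _    = sym (ℕₚ.+-identityʳ _)
  ... | no _    | yes _   = refl
  ... | no a≮b  | no b≮a  rewrite diag (ℕₚ.≤-antisym (ℕₚ.≮⇒≥ b≮a) (ℕₚ.≮⇒≥ a≮b)) = refl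

  perm-injective : ∀ {n} (g : Permutation′ n) {i j : Fin n} → g ⟨$⟩ʳ i ≡ g ⟨$⟩ʳ j → i ≡ j
  perm-injective g gi≡gj = trans (sym (Perm.inverseˡ g)) (trans (cong (g ⟨$⟩ˡ_) gi≡gj) (Perm.inverseˡ g))

  oneLine-injective : ∀ {n} (g : Permutation′ n) {i j : Fin n} → oneLine g i ≡ oneLine g j → i ≡ j
  oneLine-injective g = perm-injective g ∘ Finₚ.toℕ-injective

  module _ {n} (σ τ : Permutation′ n) where
    private
      v-τ v-στ : Fin n → ℕ
      v-τ = oneLine τ
      v-στ i = toℕ (σ ⟨$⟩ʳ (τ ⟨$⟩ʳ i))

      lt : Fin n → Fin n → Bool
      lt i j = ⌊ toℕ i <? toℕ j ⌋

      inverted : (Fin n → ℕ) → Fin n → Fin n → Bool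
      inverted v i j = ⌊ v j <? v i ⌋

      inversionsOf≡ΣΣ : ∀ v → inversionsOf v ≡ ΣΣ (λ i j → 𝟙 (lt i j ∧ inverted v i j))
      inversionsOf≡ΣΣ v = sumFin-cong (λ i → countFin≡sumFin (λ j → lt i j ∧ inverted v i j))

      -- W i j: the pair (τ i, τ j) is an inversion of σ, so inversions of σ are counted by W after reindexing by τ
      W : Fin n → Fin n → Bool
      W i j = inverted v-τ j i ∧ inverted v-στ i j

      W-diag : ∀ i j → toℕ i ≡ toℕ j → W i j ≡ false
      W-diag i j i≡j rewrite Finₚ.toℕ-injective i≡j = cong (_∧ inverted v-στ j j) (⌊⌋-no (v-τ j <? v-τ j) (ℕₚ.<-irrefl refl))

      inversions-σ : inversionsOf (oneLine σ) ≡ ΣΣ (λ i j → 𝟙 (lt i j ∧ W i j)) + ΣΣ (λ i j → 𝟙 (lt i j ∧ W j i))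
      inversions-σ = begin
        inversionsOf (oneLine σ)
          ≡⟨ inversionsOf≡ΣΣ (oneLine σ) ⟩
        ΣΣ (λ u v → 𝟙 (lt u v ∧ inverted (oneLine σ) u v))
          ≡⟨ sumFin-permute (λ u → sumFin (λ v → 𝟙 (lt u v ∧ inverted (oneLine σ) u v))) τ ⟨
        sumFin (λ i → sumFin (λ v → 𝟙 (⌊ v-τ i <? toℕ v ⌋ ∧ ⌊ oneLine σ v <? v-στ i ⌋)))
          ≡⟨ sumFin-cong (λ i → sumFin-permute (λ v → 𝟙 (⌊ v-τ i <? toℕ v ⌋ ∧ ⌊ oneLine σ v <? v-στ i ⌋)) τ) ⟨
        ΣΣ (λ i j → 𝟙 (W i j))
          ≡⟨ ΣΣ-cong (λ i j → 𝟙-split-< (toℕ i) (toℕ j) (W i j) (W-diag i j)) ⟩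
        ΣΣ (λ i j → 𝟙 (lt i j ∧ W i j) + 𝟙 (lt j i ∧ W i j))
          ≡⟨ ΣΣ-+ {n} _ _ ⟩
        ΣΣ (λ i j → 𝟙 (lt i j ∧ W i j)) + ΣΣ (λ i j → 𝟙 (lt j i ∧ W i j))
          ≡⟨ cong (ΣΣ (λ i j → 𝟙 (lt i j ∧ W i j)) +_) (sumFin-swap (λ i j → 𝟙 (lt j i ∧ W i j))) ⟩
        ΣΣ (λ i j → 𝟙 (lt i j ∧ W i j)) + ΣΣ (λ i j → 𝟙 (lt i j ∧ W j i)) ∎
        where open ≡-Reasoning

      𝟙-pair-identity : ∀ c x y →
        𝟙 (c ∧ (not x ∧ y)) + 𝟙 (c ∧ (x ∧ not y)) + 𝟙 (c ∧ x) ≡ 𝟙 (c ∧ y) + 2 * 𝟙 (c ∧ (x ∧ not y))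
      𝟙-pair-identity false x     y     = refl
      𝟙-pair-identity true  false false = refl
      𝟙-pair-identity true  false true  = refl
      𝟙-pair-identity true  true  false = refl
      𝟙-pair-identity true  true  true  = refl

      discrepancy : Fin n → Fin n → Bool
      discrepancy i j = inverted v-τ i j ∧ not (inverted v-στ i j)

      lt-true⇒≢ : ∀ i j → lt i j ≡ true → i ≢ j
      lt-true⇒≢ i j i<j refl = ℕₚ.<-irrefl refl (⌊⌋-yes⁻ (toℕ i <? toℕ i) i<j)

      pair-identity : ∀ i j →
        𝟙 (lt i j ∧ W i j) + 𝟙 (lt i j ∧ W j i) + 𝟙 (lt i j ∧ inverted v-τ i j)
          ≡ 𝟙 (lt i j ∧ inverted v-στ i j) + 2 * 𝟙 (lt i j ∧ discrepancy i j)
      pair-identity i j with lt i j in i<j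
      ... | false = refl
      ... | true
        rewrite <?-flip {v-τ i} {v-τ j} (lt-true⇒≢ i j i<j ∘ oneLine-injective τ)
              | <?-flip {v-στ i} {v-στ j} (lt-true⇒≢ i j i<j ∘ perm-injective τ ∘ oneLine-injective σ)
        = 𝟙-pair-identity true (inverted v-τ i j) (inverted v-στ i j)

      inversions-∘ : inversionsOf (oneLine σ) + inversionsOf (oneLine τ)
                   ≡ inversionsOf v-στ + 2 * ΣΣ (λ i j → 𝟙 (lt i j ∧ discrepancy i j))
      inversions-∘ = begin
        inversionsOf (oneLine σ) + inversionsOf v-τ
          ≡⟨ cong₂ _+_ inversions-σ (inversionsOf≡ΣΣ v-τ) ⟩
        ΣΣ A + ΣΣ B + ΣΣ C
          ≡⟨ trans (ΣΣ-+ (λ i j → A i j + B i j) C) (cong (_+ ΣΣ C) (ΣΣ-+ A B)) ⟨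
        ΣΣ (λ i j → A i j + B i j + C i j)
          ≡⟨ ΣΣ-cong pair-identity ⟩
        ΣΣ (λ i j → E i j + 2 * D i j)
          ≡⟨ ΣΣ-+ E (λ i j → 2 * D i j) ⟩
        ΣΣ E + ΣΣ (λ i j → 2 * D i j)
          ≡⟨ cong₂ _+_ (inversionsOf≡ΣΣ v-στ)
                       (sym (trans (sumFin-cong {n} (λ i → sumFin-double {n} (D i))) (sumFin-double {n} (sumFin ∘ D)))) ⟨
        inversionsOf v-στ + 2 * ΣΣ D ∎
        where
        open ≡-Reasoning
        A B C D E : Fin n → Fin n → ℕ
        A i j = 𝟙 (lt i j ∧ W i j)
        B i j = 𝟙 (lt i j ∧ W j i)
        C i j = 𝟙 (lt i j ∧ inverted v-τ i j)
        D i j = 𝟙 (lt i j ∧ discrepancy i j)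
        E i j = 𝟙 (lt i j ∧ inverted v-στ i j)

    odd-inversions-∘ : odd (inversionsOf (λ i → toℕ (σ ⟨$⟩ʳ (τ ⟨$⟩ʳ i))))
                     ≡ odd (inversionsOf (oneLine σ)) xor odd (inversionsOf (oneLine τ))
    odd-inversions-∘ = begin
      odd I-στ                       ≡⟨ xor-identityʳ (odd I-στ) ⟨
      odd I-στ xor false             ≡⟨ cong (odd I-στ xor_) (odd-double D) ⟨
      odd I-στ xor odd (2 * D)       ≡⟨ odd-+ I-στ (2 * D) ⟨
      odd (I-στ + 2 * D)             ≡⟨ cong odd inversions-∘ ⟨
      odd (I-σ + I-τ)                ≡⟨ odd-+ I-σ I-τ ⟩
      odd I-σ xor odd I-τ            ∎
      where
      open ≡-Reasoning
      I-σ = inversionsOf (oneLine σ)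
      I-τ = inversionsOf v-τ
      I-στ = inversionsOf v-στ
      D = ΣΣ (λ i j → 𝟙 (lt i j ∧ discrepancy i j))

  not-xor-not : ∀ x y → not x xor not y ≡ x xor y
  not-xor-not false y = not-involutive y
  not-xor-not true  y = refl

  isEven-∘ : ∀ {n} (σ τ k : Permutation′ n) → (∀ i → k ⟨$⟩ʳ i ≡ σ ⟨$⟩ʳ (τ ⟨$⟩ʳ i)) →
    isEven k ≡ not (isEven σ xor isEven τ)
  isEven-∘ σ τ k k≗στ = begin
    isEven k                                     ≡⟨ isEven≡not-odd k ⟩
    not (odd (inversionsOf (oneLine k)))         ≡⟨ cong (not ∘ odd) (inversionsOf-cong (cong toℕ ∘ k≗στ)) ⟩
    not (odd (inversionsOf (λ i → toℕ (σ ⟨$⟩ʳ (τ ⟨$⟩ʳ i)))))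
      ≡⟨ cong not (odd-inversions-∘ σ τ) ⟩
    not (odd (inversionsOf (oneLine σ)) xor odd (inversionsOf (oneLine τ)))
      ≡⟨ cong not (not-xor-not (odd (inversionsOf (oneLine σ))) (odd (inversionsOf (oneLine τ)))) ⟨
    not (not (odd (inversionsOf (oneLine σ))) xor not (odd (inversionsOf (oneLine τ))))
      ≡⟨ cong₂ (λ x y → not (x xor y)) (isEven≡not-odd σ) (isEven≡not-odd τ) ⟨
    not (isEven σ xor isEven τ)                  ∎
    where open ≡-Reasoning

  isEven-identity : ∀ {n} (e : Permutation′ n) → (∀ i → e ⟨$⟩ʳ i ≡ i) → isEven e ≡ true
  isEven-identity e e≗id = begin
    isEven e                           ≡⟨ isEven-∘ e e e (λ i → sym (cong (e ⟨$⟩ʳ_) (e≗id i))) ⟩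
    not (isEven e xor isEven e)        ≡⟨ cong not (xor-same (isEven e)) ⟩
    true                               ∎
    where open ≡-Reasoning

  isEven-inverse : ∀ {n} (g k : Permutation′ n) → (∀ i → k ⟨$⟩ʳ i ≡ g ⟨$⟩ˡ i) → isEven k ≡ isEven g
  isEven-inverse {n} g k k≗g⁻¹ = not-xor≡true⇒≡ (isEven k) (isEven g) (begin
    not (isEven k xor isEven g)   ≡⟨ cong not (xor-comm (isEven k) (isEven g)) ⟩
    not (isEven g xor isEven k)   ≡⟨ isEven-∘ g k (Perm.id {n}) id≗gk ⟨
    isEven (Perm.id {n})          ≡⟨ isEven-identity (Perm.id {n}) (λ i → refl) ⟩
    true                          ∎)
    where
    open ≡-Reasoning
    id≗gk : ∀ i → i ≡ g ⟨$⟩ʳ (k ⟨$⟩ʳ i)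
    id≗gk i = sym (trans (cong (g ⟨$⟩ʳ_) (k≗g⁻¹ i)) (Perm.inverseʳ g))
    not-xor≡true⇒≡ : ∀ x y → not (x xor y) ≡ true → x ≡ y
    not-xor≡true⇒≡ false false _ = refl
    not-xor≡true⇒≡ true  true  _ = refl

  -- Cycles

  module _ {n : ℕ} (g : Permutation′ n) where

    iter-+ : ∀ k l i → iter g (k + l) i ≡ iter g k (iter g l i)
    iter-+ zero    l i = refl
    iter-+ (suc k) l i = cong (g ⟨$⟩ʳ_) (iter-+ k l i)

    iter-injective : ∀ k {i j} → iter g k i ≡ iter g k j → i ≡ j
    iter-injective zero    eq = eq
    iter-injective (suc k) eq = iter-injective k (perm-injective g eq)

    iter-period : ∀ i → ∃ λ p → 0 < p × p ≤ n × iter g p i ≡ i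
    iter-period i with Finₚ.pigeonhole (ℕₚ.n<1+n n) (λ (k : Fin (suc n)) → iter g (toℕ k) i)
    ... | r , s , r<s , gʳi≡gˢi = toℕ s ∸ toℕ r , ℕₚ.m<n⇒0<n∸m r<s , p≤n ,
        iter-injective (toℕ r) (begin
          iter g (toℕ r) (iter g (toℕ s ∸ toℕ r) i) ≡⟨ iter-+ (toℕ r) (toℕ s ∸ toℕ r) i ⟨
          iter g (toℕ r + (toℕ s ∸ toℕ r)) i        ≡⟨ cong (λ k → iter g k i) (ℕₚ.m+[n∸m]≡n (ℕₚ.<⇒≤ r<s)) ⟩
          iter g (toℕ s) i                          ≡⟨ gʳi≡gˢi ⟨
          iter g (toℕ r) i                          ∎)
      where
      open ≡-Reasoning
      p≤n = ℕₚ.≤-trans (ℕₚ.m∸n≤m (toℕ s) (toℕ r)) (ℕₚ.≤-pred (Finₚ.toℕ<n s))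

    iter-multiple : ∀ p i → iter g p i ≡ i → ∀ q → iter g (q * p) i ≡ i
    iter-multiple p i gᵖi≡i zero    = refl
    iter-multiple p i gᵖi≡i (suc q) =
      trans (iter-+ p (q * p) i) (trans (cong (iter g p) (iter-multiple p i gᵖi≡i q)) gᵖi≡i)

    iter-reduce : ∀ i k → ∃ λ k′ → k′ < n × iter g k′ i ≡ iter g k i
    iter-reduce i k with iter-period i
    ... | suc p , _ , p≤n , gᵖi≡i = k % suc p , ℕₚ.<-≤-trans (m%n<n k (suc p)) p≤n , sym (begin
      iter g k i                                  ≡⟨ cong (λ l → iter g l i) (m≡m%n+[m/n]*n k (suc p)) ⟩
      iter g (k % suc p + k / suc p * suc p) i    ≡⟨ iter-+ (k % suc p) _ i ⟩
      iter g (k % suc p) (iter g (k / suc p * suc p) i)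
                                                  ≡⟨ cong (iter g (k % suc p)) (iter-multiple (suc p) i gᵖi≡i (k / suc p)) ⟩
      iter g (k % suc p) i                        ∎)
      where open ≡-Reasoning

    hasSmallerIterate : Fin n → Bool
    hasSmallerIterate i = anyFin {n} λ k → ⌊ toℕ (iter g (toℕ k) i) <? toℕ i ⌋

    hasSmallerIterate⁻ : ∀ i → hasSmallerIterate i ≡ true → ∃ λ k → toℕ (iter g k i) < toℕ i
    hasSmallerIterate⁻ i has =
      let k , gᵏi<i = anyFin⁻ {n} (λ k → ⌊ toℕ (iter g (toℕ k) i) <? toℕ i ⌋) has in toℕ k , ⌊⌋-yes⁻ (_ <? _) gᵏi<i

    hasSmallerIterate⁺ : ∀ i k → toℕ (iter g k i) < toℕ i → hasSmallerIterate i ≡ true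
    hasSmallerIterate⁺ i k gᵏi<i with iter-reduce i k
    ... | k′ , k′<n , gᵏ′i≡gᵏi = anyFin⁺ {n} (λ k → ⌊ toℕ (iter g (toℕ k) i) <? toℕ i ⌋) (fromℕ< k′<n) (⌊⌋-yes (_ <? _)
      (subst (λ l → toℕ (iter g l i) < toℕ i) (sym (Finₚ.toℕ-fromℕ< k′<n))
        (subst (λ x → toℕ x < toℕ i) (sym gᵏ′i≡gᵏi) gᵏi<i)))

  -- Colourings

  Colouring : ℕ → ℕ → Set
  Colouring n a = Fin n → Fin a

  snoc : ∀ {n a} → Colouring n a → Fin a → Colouring (suc n) a
  snoc {zero}  f c _       = c
  snoc {suc n} f c zero    = f zero
  snoc {suc n} f c (suc i) = snoc (f ∘ suc) c i

  snoc-last : ∀ {n a} (f : Colouring n a) c → snoc f c (fromℕ n) ≡ c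
  snoc-last {zero}  f c = refl
  snoc-last {suc n} f c = snoc-last (f ∘ suc) c

  snoc-inject₁ : ∀ {n a} (f : Colouring n a) c i → snoc f c (inject₁ i) ≡ f i
  snoc-inject₁ {suc n} f c zero    = refl
  snoc-inject₁ {suc n} f c (suc i) = snoc-inject₁ (f ∘ suc) c i

  Pointwise-invariant : ∀ {n a} → (Colouring n a → ℕ) → Set
  Pointwise-invariant {n} {a} φ = ∀ {f h : Colouring n a} → (∀ i → f i ≡ h i) → φ f ≡ φ h

  sum-allColourings-suc : ∀ n a (φ : Colouring (suc n) a → ℕ) →
    ℕΣ.sum (allColourings (suc n) a) φ ≡ sumFin {a} (λ c → ℕΣ.sum (allColourings n a) (φ ∘ cons c))
  sum-allColourings-suc n a φ = begin
    ℕΣ.sum (allColourings (suc n) a) φ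
      ≡⟨ ℕΣ.sum-concatMap (λ c → map (cons c) (allColourings n a)) (allFin a) φ ⟩
    ℕΣ.sum (allFin a) (λ c → ℕΣ.sum (map (cons c) (allColourings n a)) φ)
      ≡⟨ ℕΣ.sum-cong (allFin a) (λ c → ℕΣ.sum-map (cons c) (allColourings n a) φ) ⟩
    ℕΣ.sum (allFin a) (λ c → ℕΣ.sum (allColourings n a) (φ ∘ cons c))
      ≡⟨ sum-allFin (λ c → ℕΣ.sum (allColourings n a) (φ ∘ cons c)) ⟩
    sumFin (λ c → ℕΣ.sum (allColourings n a) (φ ∘ cons c)) ∎
    where open ≡-Reasoning

  sum-allColourings-snoc : ∀ n a (φ : Colouring (suc n) a → ℕ) → Pointwise-invariant φ →
    ℕΣ.sum (allColourings (suc n) a) φ ≡ sumFin {a} (λ c → ℕΣ.sum (allColourings n a) (λ f → φ (snoc f c)))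
  sum-allColourings-snoc zero a φ inv = trans (sum-allColourings-suc zero a φ)
    (sumFin-cong {a} λ c → cong (_+ 0) (inv {cons c (λ ())} {snoc (λ ()) c} λ { zero → refl }))
  sum-allColourings-snoc (suc n) a φ inv = begin
    ℕΣ.sum (allColourings (suc (suc n)) a) φ
      ≡⟨ sum-allColourings-suc (suc n) a φ ⟩
    sumFin (λ c₀ → ℕΣ.sum (allColourings (suc n) a) (φ ∘ cons c₀))
      ≡⟨ sumFin-cong (λ c₀ → sum-allColourings-snoc n a (φ ∘ cons c₀) (inv ∘ cons-cong)) ⟩
    sumFin (λ c₀ → sumFin (λ c → ℕΣ.sum (allColourings n a) (λ f → φ (cons c₀ (snoc f c)))))
      ≡⟨ sumFin-swap (λ c₀ c → ℕΣ.sum (allColourings n a) (λ f → φ (cons c₀ (snoc f c)))) ⟩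
    sumFin (λ c → sumFin (λ c₀ → ℕΣ.sum (allColourings n a) (λ f → φ (cons c₀ (snoc f c)))))
      ≡⟨ sumFin-cong (λ c → sumFin-cong λ c₀ → ℕΣ.sum-cong (allColourings n a) λ f → inv (cons-snoc c₀ f c)) ⟩
    sumFin (λ c → sumFin (λ c₀ → ℕΣ.sum (allColourings n a) (λ f → φ (snoc (cons c₀ f) c))))
      ≡⟨ sumFin-cong (λ c → sum-allColourings-suc n a (λ f → φ (snoc f c))) ⟨
    sumFin (λ c → ℕΣ.sum (allColourings (suc n) a) (λ f → φ (snoc f c))) ∎
    where
    open ≡-Reasoning
    cons-cong : ∀ {c₀} {f h : Colouring (suc n) a} → (∀ i → f i ≡ h i) → ∀ i → cons c₀ f i ≡ cons c₀ h i
    cons-cong f≗h zero    = refl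
    cons-cong f≗h (suc i) = f≗h i
    cons-snoc : ∀ c₀ (f : Colouring n a) c i → cons c₀ (snoc f c) i ≡ snoc (cons c₀ f) c i
    cons-snoc c₀ f c zero    = refl
    cons-snoc c₀ f c (suc i) = refl

  fixes : ∀ {n a} → Permutation′ n → Colouring n a → Bool
  fixes g f = allFin? (λ i → ⌊ f (g ⟨$⟩ʳ i) Fin.≟ f i ⌋)

  fixes-invariant : ∀ {n a} (g : Permutation′ n) → Pointwise-invariant {n} {a} (𝟙 ∘ fixes g)
  fixes-invariant g f≗h = cong 𝟙 (allFin?-cong λ i → cong₂ (λ x y → ⌊ x Fin.≟ y ⌋) (f≗h (g ⟨$⟩ʳ i)) (f≗h i))

  fixes⁺ : ∀ {n a} (g : Permutation′ n) (f : Colouring n a) → (∀ i → f (g ⟨$⟩ʳ i) ≡ f i) → fixes g f ≡ true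
  fixes⁺ g f = allFin?-≡⁺ {u = f ∘ (g ⟨$⟩ʳ_)} {v = f}

  fixes⁻ : ∀ {n a} (g : Permutation′ n) (f : Colouring n a) → fixes g f ≡ true → ∀ i → f (g ⟨$⟩ʳ i) ≡ f i
  fixes⁻ g f = allFin?-≡⁻ {u = f ∘ (g ⟨$⟩ʳ_)} {v = f}

  fixedColourings : ∀ {n} (a : ℕ) → Permutation′ n → ℕ
  fixedColourings {n} a g = countList (fixes g) (allColourings n a)

  -- Removing the last point

  transpose-matchˡ : ∀ {n} (i j : Fin n) → PC.transpose i j i ≡ j
  transpose-matchˡ i j rewrite dec-true (i Fin.≟ i) refl = refl

  transpose-matchʳ : ∀ {n} (i j : Fin n) → PC.transpose i j j ≡ i
  transpose-matchʳ i j with j Fin.≟ i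
  ... | yes j≡i = j≡i
  ... | no _ rewrite dec-true (j Fin.≟ j) refl = refl

  transpose-other : ∀ {n} {i j k : Fin n} → k ≢ i → k ≢ j → PC.transpose i j k ≡ k
  transpose-other {i = i} {j} {k} k≢i k≢j rewrite dec-false (k Fin.≟ i) k≢i | dec-false (k Fin.≟ j) k≢j = refl

  punchIn-fromℕ : ∀ {n} (j : Fin n) → Fin.punchIn (fromℕ n) j ≡ inject₁ j
  punchIn-fromℕ zero    = refl
  punchIn-fromℕ (suc j) = cong suc (punchIn-fromℕ j)

  inversionsOf-init-last : ∀ {n} (v : Fin (suc n) → ℕ) →
    inversionsOf v ≡ inversionsOf (v ∘ inject₁) + sumFin (λ i → 𝟙 ⌊ v (fromℕ n) <? v (inject₁ i) ⌋)
  inversionsOf-init-last {n} v = begin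
    inversionsOf v                              ≡⟨ sumFin-init-last row ⟩
    sumFin (row ∘ inject₁) + row (fromℕ n)      ≡⟨ cong (sumFin (row ∘ inject₁) +_) last-row ⟩
    sumFin (row ∘ inject₁) + 0                  ≡⟨ ℕₚ.+-identityʳ _ ⟩
    sumFin (row ∘ inject₁)                      ≡⟨ sumFin-cong row-inject₁ ⟩
    sumFin (λ i → row′ i + 𝟙 (lastBelow i))     ≡⟨ sumFin-+ row′ (𝟙 ∘ lastBelow) ⟩
    inversionsOf (v ∘ inject₁) + sumFin (𝟙 ∘ lastBelow) ∎
    where
    open ≡-Reasoning
    row : Fin (suc n) → ℕ
    row i = countFin λ j → ⌊ toℕ i <? toℕ j ⌋ ∧ ⌊ v j <? v i ⌋
    row′ : Fin n → ℕ
    row′ i = countFin λ j → ⌊ toℕ i <? toℕ j ⌋ ∧ ⌊ v (inject₁ j) <? v (inject₁ i) ⌋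
    lastBelow : Fin n → Bool
    lastBelow i = ⌊ v (fromℕ n) <? v (inject₁ i) ⌋
    last-row : row (fromℕ n) ≡ 0
    last-row = countFin-zero _ λ j → cong (_∧ ⌊ v j <? v (fromℕ n) ⌋) (⌊⌋-no (_ <? _)
      (ℕₚ.≤⇒≯ (subst (toℕ j ≤_) (sym (Finₚ.toℕ-fromℕ n)) (ℕₚ.≤-pred (Finₚ.toℕ<n j)))))
    row-inject₁ : ∀ i → row (inject₁ i) ≡ row′ i + 𝟙 (lastBelow i)
    row-inject₁ i = trans (countFin-init-last (λ j → ⌊ toℕ (inject₁ i) <? toℕ j ⌋ ∧ ⌊ v j <? v (inject₁ i) ⌋)) (cong₂ _+_
      (countFin-cong λ j → cong₂ (λ a b → ⌊ a <? b ⌋ ∧ ⌊ v (inject₁ j) <? v (inject₁ i) ⌋)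
        (Finₚ.toℕ-inject₁ i) (Finₚ.toℕ-inject₁ j))
      (cong (λ b → 𝟙 (b ∧ lastBelow i))
        (⌊⌋-yes (_ <? _) (subst (toℕ (inject₁ i) <_) (sym (Finₚ.toℕ-fromℕ n)) (toℕ-inject₁<n i)))))

  module _ {n : ℕ} (m′ : Fin n) where
    private
      L m : Fin (suc n)
      L = fromℕ n
      m = inject₁ m′

      v : Fin (suc n) → ℕ
      v = oneLine (Perm.transpose m L)

      inject₁≢L : ∀ {j} → inject₁ j ≢ L
      inject₁≢L = Finₚ.fromℕ≢inject₁ ∘ sym

      v-L : v L ≡ toℕ m′
      v-L = trans (cong toℕ (transpose-matchʳ m L)) (Finₚ.toℕ-inject₁ m′)

      v-m : v m ≡ n
      v-m = trans (cong toℕ (transpose-matchˡ m L)) (Finₚ.toℕ-fromℕ n)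

      v-other : ∀ j → j ≢ m′ → v (inject₁ j) ≡ toℕ j
      v-other j j≢m′ = trans (cong toℕ (transpose-other (j≢m′ ∘ Finₚ.inject₁-injective) inject₁≢L)) (Finₚ.toℕ-inject₁ j)

      v-≥ : ∀ j → toℕ j ≤ v (inject₁ j)
      v-≥ j with j Fin.≟ m′
      ... | yes refl = subst (toℕ j ≤_) (sym v-m) (ℕₚ.<⇒≤ (Finₚ.toℕ<n j))
      ... | no j≢m′  = ℕₚ.≤-reflexive (sym (v-other j j≢m′))

      K : ℕ
      K = countFin {n} λ j → ⌊ toℕ m′ <? toℕ j ⌋

      inversions-init : inversionsOf (v ∘ inject₁) ≡ K
      inversions-init = trans (sumFin-single _ m′ other-rows) row-m′
        where
        other-rows : ∀ i → i ≢ m′ → countFin (λ j → ⌊ toℕ i <? toℕ j ⌋ ∧ ⌊ v (inject₁ j) <? v (inject₁ i) ⌋) ≡ 0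
        other-rows i i≢m′ = countFin-zero _ λ j → row-entry j (toℕ i <? toℕ j)
          where
          row-entry : ∀ j (d : Dec (toℕ i < toℕ j)) → (⌊ d ⌋ ∧ ⌊ v (inject₁ j) <? v (inject₁ i) ⌋) ≡ false
          row-entry j (no _)    = refl
          row-entry j (yes i<j) = ⌊⌋-no (_ <? _) λ vj<vi →
            ℕₚ.<-asym i<j (ℕₚ.≤-<-trans (v-≥ j) (subst (v (inject₁ j) <_) (v-other i i≢m′) vj<vi))
        row-m′ : countFin (λ j → ⌊ toℕ m′ <? toℕ j ⌋ ∧ ⌊ v (inject₁ j) <? v m ⌋) ≡ K
        row-m′ = countFin-cong entry
          where
          entry : ∀ j → (⌊ toℕ m′ <? toℕ j ⌋ ∧ ⌊ v (inject₁ j) <? v m ⌋) ≡ ⌊ toℕ m′ <? toℕ j ⌋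
          entry j with j Fin.≟ m′
          ... | yes refl = let j≮j = ⌊⌋-no (toℕ j <? toℕ j) (ℕₚ.<-irrefl refl) in
                           trans (cong (_∧ ⌊ v (inject₁ j) <? v m ⌋) j≮j) (sym j≮j)
          ... | no j≢m′  = trans (cong (⌊ toℕ m′ <? toℕ j ⌋ ∧_)
                  (⌊⌋-yes (_ <? _) (subst₂ _<_ (sym (v-other j j≢m′)) (sym v-m) (Finₚ.toℕ<n j))))
                  (∧-identityʳ _)

      last-column : sumFin (λ i → 𝟙 ⌊ v L <? v (inject₁ i) ⌋) ≡ K + 1
      last-column = begin
        sumFin (λ i → 𝟙 ⌊ v L <? v (inject₁ i) ⌋)
          ≡⟨ sumFin-cong entry ⟩
        sumFin (λ i → 𝟙 ⌊ toℕ m′ <? toℕ i ⌋ + 𝟙 ⌊ i Fin.≟ m′ ⌋)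
          ≡⟨ sumFin-+ (λ i → 𝟙 ⌊ toℕ m′ <? toℕ i ⌋) (λ i → 𝟙 ⌊ i Fin.≟ m′ ⌋) ⟩
        sumFin {n} (λ i → 𝟙 ⌊ toℕ m′ <? toℕ i ⌋) + sumFin (λ i → 𝟙 ⌊ i Fin.≟ m′ ⌋)
          ≡⟨ cong₂ _+_ (sym (countFin≡sumFin {n} (λ i → ⌊ toℕ m′ <? toℕ i ⌋)))
                       (trans (sumFin-single _ m′ (λ i i≢m′ → cong 𝟙 (⌊⌋-no (i Fin.≟ m′) i≢m′)))
                                                        (cong 𝟙 (⌊⌋-yes (m′ Fin.≟ m′) refl))) ⟩
        K + 1 ∎
        where
        open ≡-Reasoning
        entry : ∀ i → 𝟙 ⌊ v L <? v (inject₁ i) ⌋ ≡ 𝟙 ⌊ toℕ m′ <? toℕ i ⌋ + 𝟙 ⌊ i Fin.≟ m′ ⌋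
        entry i with i Fin.≟ m′
        ... | yes refl = trans (cong 𝟙 (⌊⌋-yes (_ <? _) (subst₂ _<_ (sym v-L) (sym v-m) (Finₚ.toℕ<n i))))
                               (cong (λ b → 𝟙 b + 1) (sym (⌊⌋-no (_ <? _) (ℕₚ.<-irrefl refl))))
        ... | no i≢m′  = trans (cong₂ (λ a b → 𝟙 ⌊ a <? b ⌋) v-L (v-other i i≢m′)) (sym (ℕₚ.+-identityʳ _))

      inversions-transpose-last : inversionsOf v ≡ 2 * K + 1
      inversions-transpose-last = begin
        inversionsOf v                     ≡⟨ inversionsOf-init-last v ⟩
        inversionsOf (v ∘ inject₁) + _     ≡⟨ cong₂ _+_ inversions-init last-column ⟩
        K + (K + 1)                        ≡⟨ ℕₚ.+-assoc K K 1 ⟨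
        K + K + 1                          ≡⟨ cong (λ k → K + k + 1) (ℕₚ.+-identityʳ K) ⟨
        2 * K + 1                          ∎
        where open ≡-Reasoning

    odd-inversions-transpose-last : odd (inversionsOf (oneLine (Perm.transpose (inject₁ m′) (fromℕ n)))) ≡ true
    odd-inversions-transpose-last = begin
      odd (inversionsOf v)       ≡⟨ cong odd inversions-transpose-last ⟩
      odd (2 * K + 1)            ≡⟨ odd-+ (2 * K) 1 ⟩
      odd (2 * K) xor true       ≡⟨ cong (_xor true) (odd-double K) ⟩
      true                       ∎
      where open ≡-Reasoning

  transpose-same : ∀ {n} (i k : Fin n) → PC.transpose i i k ≡ k
  transpose-same i k = by-cases (k Fin.≟ i)
    where
    by-cases : Dec (k ≡ i) → PC.transpose i i k ≡ k
    by-cases (yes refl) = transpose-matchˡ k k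
    by-cases (no k≢i)   = transpose-other k≢i k≢i

  isEven-transpose-last : ∀ {n} (m : Fin (suc n)) (d : Dec (m ≡ fromℕ n)) →
    isEven (Perm.transpose m (fromℕ n)) ≡ ⌊ d ⌋
  isEven-transpose-last {n} m (yes refl) = isEven-identity (Perm.transpose m m) (transpose-same m)
  isEven-transpose-last {n} m (no m≢L) with last-or-inject₁ m
  ... | inj₁ m≡L         = contradiction m≡L m≢L
  ... | inj₂ (m′ , refl) = trans (isEven≡not-odd (Perm.transpose (inject₁ m′) (fromℕ n)))
                                 (cong not (odd-inversions-transpose-last m′))

  module LastPoint {n : ℕ} (g : Permutation′ (suc n)) where

    L m : Fin (suc n)
    L = fromℕ n
    m = g ⟨$⟩ʳ L

    fixesLast : Bool
    fixesLast = ⌊ m Fin.≟ L ⌋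

    -- ∘ₚ is diagrammatic: τ y = transpose L m (g y), so τ fixes L and g = transpose m L ∘ τ
    τ : Permutation′ (suc n)
    τ = g ∘ₚ Perm.transpose L m

    τ-fixes-L : τ ⟨$⟩ʳ L ≡ L
    τ-fixes-L = transpose-matchʳ L m

    -- opaque, so that unification never unfolds the punchIn/punchOut construction of Perm.remove
    opaque
      ρ : Permutation′ n
      ρ = Perm.remove L τ

      inject₁-ρ : ∀ x → inject₁ (ρ ⟨$⟩ʳ x) ≡ τ ⟨$⟩ʳ inject₁ x
      inject₁-ρ x = begin
        inject₁ (ρ ⟨$⟩ʳ x)                    ≡⟨ punchIn-fromℕ (ρ ⟨$⟩ʳ x) ⟨
        Fin.punchIn L (ρ ⟨$⟩ʳ x)              ≡⟨ cong (λ y → Fin.punchIn y (ρ ⟨$⟩ʳ x)) τ-fixes-L ⟨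
        Fin.punchIn (τ ⟨$⟩ʳ L) (ρ ⟨$⟩ʳ x)     ≡⟨ Perm.punchIn-permute τ L x ⟨
        τ ⟨$⟩ʳ Fin.punchIn L x                ≡⟨ cong (τ ⟨$⟩ʳ_) (punchIn-fromℕ x) ⟩
        τ ⟨$⟩ʳ inject₁ x                      ∎
        where open ≡-Reasoning

    ρ-at-preimage : ∀ x → g ⟨$⟩ʳ inject₁ x ≡ L → inject₁ (ρ ⟨$⟩ʳ x) ≡ m
    ρ-at-preimage x gx≡L = trans (inject₁-ρ x) (trans (cong (PC.transpose L m) gx≡L) (transpose-matchˡ L m))

    ρ-elsewhere : ∀ x → g ⟨$⟩ʳ inject₁ x ≢ L → inject₁ (ρ ⟨$⟩ʳ x) ≡ g ⟨$⟩ʳ inject₁ x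
    ρ-elsewhere x gx≢L = trans (inject₁-ρ x) (transpose-other gx≢L (Finₚ.fromℕ≢inject₁ ∘ sym ∘ perm-injective g))

    ρ-orbit⊆g-orbit : ∀ x k → ∃ λ k′ → iter g k′ (inject₁ x) ≡ inject₁ (iter ρ k x)
    ρ-orbit⊆g-orbit x zero    = 0 , refl
    ρ-orbit⊆g-orbit x (suc k) with ρ-orbit⊆g-orbit x k | g ⟨$⟩ʳ inject₁ (iter ρ k x) Fin.≟ L
    ... | k′ , gᵏ′x≡ρᵏx | yes gρᵏx≡L = suc (suc k′) ,
          trans (cong (λ y → g ⟨$⟩ʳ (g ⟨$⟩ʳ y)) gᵏ′x≡ρᵏx)
                (trans (cong (g ⟨$⟩ʳ_) gρᵏx≡L) (sym (ρ-at-preimage (iter ρ k x) gρᵏx≡L)))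
    ... | k′ , gᵏ′x≡ρᵏx | no gρᵏx≢L = suc k′ ,
          trans (cong (g ⟨$⟩ʳ_) gᵏ′x≡ρᵏx) (sym (ρ-elsewhere (iter ρ k x) gρᵏx≢L))

    g-orbit⊆ρ-orbit : ∀ x k →
      (∃ λ k′ → inject₁ (iter ρ k′ x) ≡ iter g k (inject₁ x)) ⊎
      (iter g k (inject₁ x) ≡ L × ∃ λ k′ → g ⟨$⟩ʳ inject₁ (iter ρ k′ x) ≡ L)
    g-orbit⊆ρ-orbit x zero = inj₁ (0 , refl)
    g-orbit⊆ρ-orbit x (suc k) with g-orbit⊆ρ-orbit x k
    ... | inj₂ (gᵏx≡L , k′ , gρᵏ′x≡L) =
          inj₁ (suc k′ , trans (ρ-at-preimage (iter ρ k′ x) gρᵏ′x≡L) (sym (cong (g ⟨$⟩ʳ_) gᵏx≡L)))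
    ... | inj₁ (k′ , ρᵏ′x≡gᵏx) with g ⟨$⟩ʳ inject₁ (iter ρ k′ x) Fin.≟ L
    ...   | yes gρᵏ′x≡L = inj₂ (trans (cong (g ⟨$⟩ʳ_) (sym ρᵏ′x≡gᵏx)) gρᵏ′x≡L , k′ , gρᵏ′x≡L)
    ...   | no gρᵏ′x≢L  = inj₁ (suc k′ , trans (ρ-elsewhere (iter ρ k′ x) gρᵏ′x≢L) (cong (g ⟨$⟩ʳ_) ρᵏ′x≡gᵏx))

    hasSmallerIterate-inject₁ : ∀ x → hasSmallerIterate g (inject₁ x) ≡ hasSmallerIterate ρ x
    hasSmallerIterate-inject₁ x = ⇔→≡ {z = true} (mk⇔ to from)
      where
      to : hasSmallerIterate g (inject₁ x) ≡ true → hasSmallerIterate ρ x ≡ true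
      to has with hasSmallerIterate⁻ g (inject₁ x) has
      ... | k , gᵏx<x with g-orbit⊆ρ-orbit x k
      ...   | inj₁ (k′ , ρᵏ′x≡gᵏx) = hasSmallerIterate⁺ ρ x k′
              (subst₂ _<_ (trans (cong toℕ (sym ρᵏ′x≡gᵏx)) (Finₚ.toℕ-inject₁ _)) (Finₚ.toℕ-inject₁ x) gᵏx<x)
      ...   | inj₂ (gᵏx≡L , _) = contradiction
              (subst (_< toℕ (inject₁ x)) (trans (cong toℕ gᵏx≡L) (Finₚ.toℕ-fromℕ n)) gᵏx<x)
              (ℕₚ.<⇒≯ (toℕ-inject₁<n x))

      from : hasSmallerIterate ρ x ≡ true → hasSmallerIterate g (inject₁ x) ≡ true
      from has with hasSmallerIterate⁻ ρ x has
      ... | k , ρᵏx<x with ρ-orbit⊆g-orbit x k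
      ...   | k′ , gᵏ′x≡ρᵏx = hasSmallerIterate⁺ g (inject₁ x) k′
              (subst₂ _<_ (trans (sym (Finₚ.toℕ-inject₁ _)) (cong toℕ (sym gᵏ′x≡ρᵏx))) (sym (Finₚ.toℕ-inject₁ x)) ρᵏx<x)

    not-hasSmallerIterate-L : (d : Dec (m ≡ L)) → not (hasSmallerIterate g L) ≡ ⌊ d ⌋
    not-hasSmallerIterate-L (yes m≡L) = cong not (⇔→≡ {z = true} (mk⇔ (λ has → contradiction has (noSmaller has)) λ ()))
      where
      gᵏL≡L : ∀ k → iter g k L ≡ L
      gᵏL≡L zero    = refl
      gᵏL≡L (suc k) = trans (cong (g ⟨$⟩ʳ_) (gᵏL≡L k)) m≡L
      noSmaller : hasSmallerIterate g L ≡ true → hasSmallerIterate g L ≢ true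
      noSmaller has _ = let k , gᵏL<L = hasSmallerIterate⁻ g L has in ℕₚ.<-irrefl (cong toℕ (gᵏL≡L k)) gᵏL<L
    not-hasSmallerIterate-L (no m≢L) =
      cong not (hasSmallerIterate⁺ g L 1 (subst (toℕ m <_) (sym (Finₚ.toℕ-fromℕ n)) (toℕ<n-of≢fromℕ m≢L)))

    cycles-remove : cycles g ≡ cycles ρ + 𝟙 fixesLast
    cycles-remove = trans (countFin-init-last (not ∘ hasSmallerIterate g))
      (cong₂ _+_ (countFin-cong (cong not ∘ hasSmallerIterate-inject₁)) (cong 𝟙 (not-hasSmallerIterate-L (m Fin.≟ L))))

    isEven-τ : isEven τ ≡ isEven ρ
    isEven-τ = begin
      isEven τ
        ≡⟨ isEven≡not-odd τ ⟩
      not (odd (inversionsOf (oneLine τ)))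
        ≡⟨ cong (not ∘ odd) (inversionsOf-init-last (oneLine τ)) ⟩
      not (odd (inversionsOf (oneLine τ ∘ inject₁) + sumFin lastColumn))
        ≡⟨ cong₂ (λ a b → not (odd (a + b))) restrict no-last ⟩
      not (odd (inversionsOf (oneLine ρ) + 0))
        ≡⟨ cong (not ∘ odd) (ℕₚ.+-identityʳ (inversionsOf (oneLine ρ))) ⟩
      not (odd (inversionsOf (oneLine ρ)))
        ≡⟨ isEven≡not-odd ρ ⟨
      isEven ρ ∎
      where
      open ≡-Reasoning
      lastColumn : Fin n → ℕ
      lastColumn i = 𝟙 ⌊ oneLine τ L <? oneLine τ (inject₁ i) ⌋
      restrict : inversionsOf (oneLine τ ∘ inject₁) ≡ inversionsOf (oneLine ρ)
      restrict = inversionsOf-cong λ i → trans (cong toℕ (sym (inject₁-ρ i))) (Finₚ.toℕ-inject₁ _)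
      no-last : sumFin lastColumn ≡ 0
      no-last = sumFin-zero lastColumn λ i → cong 𝟙 (⌊⌋-no (_ <? _)
        (ℕₚ.≤⇒≯ (subst (toℕ (τ ⟨$⟩ʳ inject₁ i) ≤_) (sym (trans (cong toℕ τ-fixes-L) (Finₚ.toℕ-fromℕ n)))
                                                   (ℕₚ.≤-pred (Finₚ.toℕ<n _)))))

    isEven-remove : isEven g ≡ not (fixesLast xor isEven ρ)
    isEven-remove = begin
      isEven g                                          ≡⟨ isEven-∘ t τ g (λ i → sym (PC.transpose-inverse m L)) ⟩
      not (isEven t xor isEven τ)                       ≡⟨ cong₂ (λ a b → not (a xor b))
                                                             (isEven-transpose-last m (m Fin.≟ L)) isEven-τ ⟩
      not (fixesLast xor isEven ρ)                      ∎
      where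
      open ≡-Reasoning
      t = Perm.transpose m L

    colour-∘g : ∀ {a} (f : Colouring (suc n) a) → f m ≡ f L → ∀ x → f (g ⟨$⟩ʳ inject₁ x) ≡ f (inject₁ (ρ ⟨$⟩ʳ x))
    colour-∘g f fm≡fL x with g ⟨$⟩ʳ inject₁ x Fin.≟ L
    ... | yes gx≡L = trans (cong f gx≡L) (trans (sym fm≡fL) (cong f (sym (ρ-at-preimage x gx≡L))))
    ... | no gx≢L  = cong f (sym (ρ-elsewhere x gx≢L))

    fixes-snoc : ∀ {a} (f′ : Colouring n a) c → fixes g (snoc f′ c) ≡ fixes ρ f′ ∧ ⌊ snoc f′ c m Fin.≟ c ⌋
    fixes-snoc f′ c = ⇔→≡ {z = true} (mk⇔ to from)
      where
      f = snoc f′ c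
      fL≡c = snoc-last f′ c
      f∘inject₁ : ∀ x → f (inject₁ x) ≡ f′ x
      f∘inject₁ = snoc-inject₁ f′ c

      to : fixes g f ≡ true → (fixes ρ f′ ∧ ⌊ f m Fin.≟ c ⌋) ≡ true
      to fix = cong₂ _∧_ (fixes⁺ ρ f′ ρ-fixes) (⌊⌋-yes (f m Fin.≟ c) (trans (fg≗f L) fL≡c))
        where
        fg≗f = fixes⁻ g f fix
        ρ-fixes : ∀ x → f′ (ρ ⟨$⟩ʳ x) ≡ f′ x
        ρ-fixes x = begin
          f′ (ρ ⟨$⟩ʳ x)                ≡⟨ f∘inject₁ (ρ ⟨$⟩ʳ x) ⟨
          f (inject₁ (ρ ⟨$⟩ʳ x))       ≡⟨ colour-∘g f (fg≗f L) x ⟨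
          f (g ⟨$⟩ʳ inject₁ x)         ≡⟨ fg≗f (inject₁ x) ⟩
          f (inject₁ x)                ≡⟨ f∘inject₁ x ⟩
          f′ x                         ∎
          where open ≡-Reasoning

      from : (fixes ρ f′ ∧ ⌊ f m Fin.≟ c ⌋) ≡ true → fixes g f ≡ true
      from both = fixes⁺ g f fg≗f
        where
        f′ρ≗f′ = fixes⁻ ρ f′ (∧-conicalˡ _ _ both)
        fm≡fL : f m ≡ f L
        fm≡fL = trans (⌊⌋-yes⁻ (f m Fin.≟ c) (∧-conicalʳ _ _ both)) (sym fL≡c)
        fg≗f : ∀ y → f (g ⟨$⟩ʳ y) ≡ f y
        fg≗f y with last-or-inject₁ y
        ... | inj₁ refl        = fm≡fL
        ... | inj₂ (x , refl) = begin
          f (g ⟨$⟩ʳ inject₁ x)         ≡⟨ colour-∘g f fm≡fL x ⟩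
          f (inject₁ (ρ ⟨$⟩ʳ x))       ≡⟨ f∘inject₁ (ρ ⟨$⟩ʳ x) ⟩
          f′ (ρ ⟨$⟩ʳ x)                ≡⟨ f′ρ≗f′ x ⟩
          f′ x                         ≡⟨ f∘inject₁ x ⟨
          f (inject₁ x)                ∎
          where open ≡-Reasoning

    fixedColourings-remove : ∀ a → fixedColourings a g ≡ a ^ 𝟙 fixesLast * fixedColourings a ρ
    fixedColourings-remove a = trans by-last-colour (by-cases (m Fin.≟ L))
      where
      count : Fin a → ℕ
      count c = countList (λ f′ → fixes ρ f′ ∧ ⌊ snoc f′ c m Fin.≟ c ⌋) (allColourings n a)

      by-last-colour : fixedColourings a g ≡ sumFin count
      by-last-colour = trans (sum-allColourings-snoc n a (𝟙 ∘ fixes g) (fixes-invariant g))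
        (sumFin-cong λ c → ℕΣ.sum-cong (allColourings n a) λ f′ → cong 𝟙 (fixes-snoc f′ c))

      by-cases : (d : Dec (m ≡ L)) → sumFin count ≡ a ^ 𝟙 ⌊ d ⌋ * fixedColourings a ρ
      by-cases (yes m≡L) = begin
        sumFin count                           ≡⟨ sumFin-cong (λ c → ℕΣ.sum-cong (allColourings n a) λ f′ →
                                                     cong 𝟙 (trans (cong (fixes ρ f′ ∧_) (⌊⌋-yes (snoc f′ c m Fin.≟ c)
                                                       (trans (cong (snoc f′ c) m≡L) (snoc-last f′ c)))) (∧-identityʳ _))) ⟩
        sumFin {a} (λ _ → fixedColourings a ρ)  ≡⟨ sumFin-const a (fixedColourings a ρ) ⟩
        a * fixedColourings a ρ                ≡⟨ cong (_* fixedColourings a ρ) (ℕₚ.*-identityʳ a) ⟨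
        a ^ 1 * fixedColourings a ρ            ∎
        where open ≡-Reasoning
      by-cases (no m≢L) with last-or-inject₁ m
      ... | inj₁ m≡L = contradiction m≡L m≢L
      ... | inj₂ (m′ , m≡m′) = begin
        sumFin count
          ≡⟨ sumFin-cong (λ c → ℕΣ.sum-cong (allColourings n a) λ f′ →
               cong (λ y → 𝟙 (fixes ρ f′ ∧ ⌊ y Fin.≟ c ⌋)) (trans (cong (snoc f′ c) m≡m′) (snoc-inject₁ f′ c m′))) ⟩
        sumFin (λ c → ℕΣ.sum (allColourings n a) (λ f′ → 𝟙 (fixes ρ f′ ∧ ⌊ f′ m′ Fin.≟ c ⌋)))
          ≡⟨ sumFin-sum-swap (allColourings n a) (λ c f′ → 𝟙 (fixes ρ f′ ∧ ⌊ f′ m′ Fin.≟ c ⌋)) ⟩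
        ℕΣ.sum (allColourings n a) (λ f′ → sumFin (λ c → 𝟙 (fixes ρ f′ ∧ ⌊ f′ m′ Fin.≟ c ⌋)))
          ≡⟨ ℕΣ.sum-cong (allColourings n a) one-colour ⟩
        fixedColourings a ρ
          ≡⟨ ℕₚ.+-identityʳ _ ⟨
        1 * fixedColourings a ρ ∎
        where
        open ≡-Reasoning
        one-colour : ∀ f′ → sumFin (λ c → 𝟙 (fixes ρ f′ ∧ ⌊ f′ m′ Fin.≟ c ⌋)) ≡ 𝟙 (fixes ρ f′)
        one-colour f′ with fixes ρ f′
        ... | false = sumFin-zero {a} _ (λ _ → refl)
        ... | true  = trans (sumFin-single _ (f′ m′) (λ c c≢f′m′ → cong 𝟙 (⌊⌋-no (f′ m′ Fin.≟ c) (c≢f′m′ ∘ sym))))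
                            (cong 𝟙 (⌊⌋-yes (f′ m′ Fin.≟ f′ m′) refl))

  fixedColourings≡^cycles : ∀ (a : ℕ) {n} (g : Permutation′ n) → fixedColourings a g ≡ a ^ cycles g
  fixedColourings≡^cycles a {zero}  g = refl
  fixedColourings≡^cycles a {suc n} g = begin
    fixedColourings a g                  ≡⟨ fixedColourings-remove a ⟩
    a ^ 𝟙 fixesLast * fixedColourings a ρ ≡⟨ cong (a ^ 𝟙 fixesLast *_) (fixedColourings≡^cycles a ρ) ⟩
    a ^ 𝟙 fixesLast * a ^ cycles ρ       ≡⟨ ℕₚ.^-distribˡ-+-* a (𝟙 fixesLast) (cycles ρ) ⟨
    a ^ (𝟙 fixesLast + cycles ρ)         ≡⟨ cong (a ^_) (trans (ℕₚ.+-comm (𝟙 fixesLast) (cycles ρ)) (sym cycles-remove)) ⟩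
    a ^ cycles g                         ∎
    where
    open ≡-Reasoning
    open LastPoint g

  isEven≡not-odd-n+cycles : ∀ {n} (g : Permutation′ n) → isEven g ≡ not (odd (n + cycles g))
  isEven≡not-odd-n+cycles {zero}  g = refl
  isEven≡not-odd-n+cycles {suc n} g = begin
    isEven g                                  ≡⟨ isEven-remove ⟩
    not (fixesLast xor isEven ρ)              ≡⟨ cong (λ e → not (fixesLast xor e)) (isEven≡not-odd-n+cycles ρ) ⟩
    not (fixesLast xor not (odd (n + c)))     ≡⟨ cong not (xor-not-comm fixesLast (odd (n + c))) ⟩
    not (not (odd (n + c) xor fixesLast))
      ≡⟨ cong (not ∘ not) (trans (odd-+ (n + c) (𝟙 fixesLast)) (cong (odd (n + c) xor_) (odd-𝟙 fixesLast))) ⟨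
    not (odd (suc (n + c + 𝟙 fixesLast)))
      ≡⟨ cong (λ k → not (odd (suc k))) (trans (ℕₚ.+-assoc n c _) (cong (n +_) (sym cycles-remove))) ⟩
    not (odd (suc n + cycles g))              ∎
    where
    open ≡-Reasoning
    open LastPoint g
    c = cycles ρ
    odd-𝟙 : ∀ b → odd (𝟙 b) ≡ b
    odd-𝟙 false = refl
    odd-𝟙 true  = refl
    xor-not-comm : ∀ b o → b xor not o ≡ not (o xor b)
    xor-not-comm false false = refl
    xor-not-comm false true  = refl
    xor-not-comm true  false = refl
    xor-not-comm true  true  = refl

module OrbitCount where

  open CycleCount
  open import Data.Bool using (Bool; true; false; if_then_else_; not; _∧_; _xor_)
  open import Data.Bool.Properties using (T-≡; ⇔→≡; not-involutive; ∧-conicalˡ; ∧-conicalʳ)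
  open import Data.Nat as ℕ using (ℕ; zero; suc; _+_; _≤_)
  import Data.Nat.Properties as ℕₚ
  open import Data.Fin as Fin using (Fin; zero; suc)
  open import Data.Fin.Permutation as Perm using (Permutation′; _⟨$⟩ʳ_; _⟨$⟩ˡ_)
  open import Data.List using (List; []; _∷_; _ʳ++_; map)
  open import Data.List.Relation.Unary.Any as Any using (Any; here; there)
  open import Data.List.Relation.Unary.All as All using (All; []; _∷_)
  import Data.List.Relation.Unary.AllPairs.Properties as AllPairsₚ
  import Data.List.Relation.Unary.Any.Properties as Anyₚ
  open import Data.List.Membership.Propositional using (_∈_; find; lose)
  open import Data.List.Membership.Propositional.Properties using (∈-filter⁺; ∈-filter⁻; ∈-allFin)
  open import Data.Product using (_,_; _×_; proj₁)
  open import Data.Sum using (inj₁; inj₂)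
  open import Function using (_∘_)
  open import Function.Bundles using (Equivalence; mk⇔)
  open import Relation.Binary.PropositionalEquality using (_≡_; refl; sym; trans; cong; cong₂; module ≡-Reasoning)
  open import Relation.Nullary using (⌊_⌋; contradiction)
  open import Relation.Nullary.Decidable using (T?)

  hasOddSymmetry : ∀ {n a} → List (Permutation′ n) → Colouring n a → Bool
  hasOddSymmetry G f = anyList (λ g → not (isEven g) ∧ fixes g f) G

  hasOddSymmetry-cong : ∀ {n a} (G : List (Permutation′ n)) {f h : Colouring n a} → (∀ i → f i ≡ h i) →
    hasOddSymmetry G f ≡ hasOddSymmetry G h
  hasOddSymmetry-cong G f≗h = anyList-cong G λ g → cong (not (isEven g) ∧_)
    (allFin?-cong λ i → cong₂ (λ x y → ⌊ x Fin.≟ y ⌋) (f≗h (g ⟨$⟩ʳ i)) (f≗h i))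

  MapsTo : ∀ {n a} → Colouring n a → Colouring n a → Permutation′ n → Set
  MapsTo f f′ h = ∀ i → f (h ⟨$⟩ʳ i) ≡ f′ i

  module _ {n a : ℕ} (H : List (Permutation′ n)) where

    sameOrbit⁺ : ∀ (f f′ : Colouring n a) → Any (MapsTo f f′) H → sameOrbit H f f′ ≡ true
    sameOrbit⁺ f f′ = anyList⁺ _ ∘ Any.map (λ {h} → allFin?-≡⁺ {u = f ∘ (h ⟨$⟩ʳ_)} {v = f′})

    sameOrbit⁻ : ∀ (f f′ : Colouring n a) → sameOrbit H f f′ ≡ true → Any (MapsTo f f′) H
    sameOrbit⁻ f f′ = Any.map (λ {h} → allFin?-≡⁻ {u = f ∘ (h ⟨$⟩ʳ_)} {v = f′}) ∘ anyList⁻ _ H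

    sameOrbit-cong : ∀ {f g f′ g′ : Colouring n a} → (∀ i → f i ≡ g i) → (∀ i → f′ i ≡ g′ i) →
      sameOrbit H f f′ ≡ sameOrbit H g g′
    sameOrbit-cong f≗g f′≗g′ = anyList-cong H λ h →
      allFin?-cong λ i → cong₂ (λ x y → ⌊ x Fin.≟ y ⌋) (f≗g (h ⟨$⟩ʳ i)) (f′≗g′ i)

  module _ {n a : ℕ} {H : List (Permutation′ n)} (group : IsPermGroup H) where
    open IsPermGroup group

    sameOrbit-refl : ∀ (f : Colouring n a) → sameOrbit H f f ≡ true
    sameOrbit-refl f = sameOrbit⁺ H f f (Any.map (λ e≗id → cong f ∘ e≗id) hasId)

    sameOrbit-sym : ∀ (f f′ : Colouring n a) → sameOrbit H f f′ ≡ true → sameOrbit H f′ f ≡ true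
    sameOrbit-sym f f′ f~f′ with find (sameOrbit⁻ H f f′ f~f′)
    ... | h , h∈H , fh≗f′ = sameOrbit⁺ H f′ f (Any.map
      (λ k≗h⁻¹ i → trans (cong f′ (k≗h⁻¹ i)) (trans (sym (fh≗f′ (h ⟨$⟩ˡ i))) (cong f (Perm.inverseʳ h))))
      (inverses h∈H))

    sameOrbit-trans : ∀ (f f′ f″ : Colouring n a) → sameOrbit H f f′ ≡ true → sameOrbit H f′ f″ ≡ true →
      sameOrbit H f f″ ≡ true
    sameOrbit-trans f f′ f″ f~f′ f′~f″ with find (sameOrbit⁻ H f f′ f~f′) | find (sameOrbit⁻ H f′ f″ f′~f″)
    ... | h₁ , h₁∈H , fh₁≗f′ | h₂ , h₂∈H , f′h₂≗f″ = sameOrbit⁺ H f f″ (Any.map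
      (λ k≗h₁h₂ i → trans (cong f (k≗h₁h₂ i)) (trans (fh₁≗f′ (h₂ ⟨$⟩ʳ i)) (f′h₂≗f″ i)))
      (closed h₁∈H h₂∈H))

  module _ {n : ℕ} {G : List (Permutation′ n)} where

    ∈-evenPart⁻ : ∀ {g} → g ∈ evenPart G → g ∈ G × isEven g ≡ true
    ∈-evenPart⁻ g∈N = let g∈G , even = ∈-filter⁻ (T? ∘ isEven) g∈N in g∈G , Equivalence.to T-≡ even

    evenPart⁺ : ∀ {P : Permutation′ n → Set} → Any (λ g → P g × isEven g ≡ true) G → Any P (evenPart G)
    evenPart⁺ any = let g , g∈G , pg , even = find any in
      lose (∈-filter⁺ (T? ∘ isEven) g∈G (Equivalence.from T-≡ even)) pg

    evenPart-isPermGroup : IsPermGroup G → IsPermGroup (evenPart G)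
    evenPart-isPermGroup group = record
      { distinct = AllPairsₚ.filter⁺ (T? ∘ isEven) distinct
      ; hasId    = evenPart⁺ (Any.map (λ {e} e≗id → e≗id , isEven-identity e e≗id) hasId)
      ; closed   = λ {g} {h} g∈N h∈N →
          let g∈G , g-even = ∈-evenPart⁻ g∈N
              h∈G , h-even = ∈-evenPart⁻ h∈N
          in evenPart⁺ (Any.map
               (λ {k} k≗gh → k≗gh , trans (isEven-∘ g h k k≗gh) (cong₂ (λ x y → not (x xor y)) g-even h-even))
               (closed g∈G h∈G))
      ; inverses = λ {g} g∈N →
          let g∈G , g-even = ∈-evenPart⁻ g∈N
          in evenPart⁺ (Any.map (λ {k} k≗g⁻¹ → k≗g⁻¹ , trans (isEven-inverse g k k≗g⁻¹) g-even) (inverses g∈G))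
      }
      where open IsPermGroup group

  equal-sums-of-≤ : ∀ {a b c d} → a ≤ b → c ≤ d → a + c ≡ b + d → a ≡ b × c ≡ d
  equal-sums-of-≤ {a} {b} {c} {d} a≤b c≤d a+c≡b+d with ℕₚ.m≤n⇒m<n∨m≡n a≤b
  ... | inj₂ refl = refl , ℕₚ.+-cancelˡ-≡ a c d a+c≡b+d
  ... | inj₁ a<b  = contradiction a+c≡b+d (ℕₚ.<⇒≢ (ℕₚ.+-mono-<-≤ a<b c≤d))

  ∈-ʳ++⁺ʳ : ∀ {A : Set} (xs : List A) {ys} {y} → y ∈ ys → y ∈ xs ʳ++ ys
  ∈-ʳ++⁺ʳ []       y∈ys = y∈ys
  ∈-ʳ++⁺ʳ (x ∷ xs) y∈ys = ∈-ʳ++⁺ʳ xs (there y∈ys)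

  ∈-ʳ++⁺ˡ : ∀ {A : Set} {xs : List A} {ys} {y} → y ∈ xs → y ∈ xs ʳ++ ys
  ∈-ʳ++⁺ˡ {xs = x ∷ xs} (here refl) = ∈-ʳ++⁺ʳ xs (here refl)
  ∈-ʳ++⁺ˡ {xs = x ∷ xs} (there y∈xs) = ∈-ʳ++⁺ˡ y∈xs

  module CountNew {n a : ℕ} {G N : List (Permutation′ n)} (G-group : IsPermGroup G) (N-group : IsPermGroup N)
                  (N-orbit⇒G-orbit : ∀ (f f′ : Colouring n a) → sameOrbit N f f′ ≡ true → sameOrbit G f f′ ≡ true) where

    private
      S R : Colouring n a → Colouring n a → Bool
      S = sameOrbit G
      R = sameOrbit N

      fresh : List (Permutation′ n) → List (Colouring n a) → Colouring n a → ℕ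
      fresh H seen x = if anyList (λ f′ → sameOrbit H f′ x) seen then 0 else 1

    countNew-cong : (∀ f f′ → S f f′ ≡ R f f′) → ∀ seen xs → countNew G seen xs ≡ countNew N seen xs
    countNew-cong S≗R seen []       = refl
    countNew-cong S≗R seen (x ∷ xs) =
      cong₂ _+_ (cong (λ b → if b then 0 else 1) (anyList-cong seen (λ f′ → S≗R f′ x))) (countNew-cong S≗R (x ∷ seen) xs)

    fresh-≤ : ∀ seen x → fresh G seen x ≤ fresh N seen x
    fresh-≤ seen x with anyList (λ f′ → R f′ x) seen in R-old | anyList (λ f′ → S f′ x) seen in S-old
    ... | false | false = ℕₚ.≤-refl
    ... | false | true  = ℕ.z≤n
    ... | true  | true  = ℕₚ.≤-refl
    ... | true  | false = contradiction
      (trans (sym S-old) (anyList⁺ _ (Any.map (λ {f′} → N-orbit⇒G-orbit f′ x) (anyList⁻ _ seen R-old)))) λ ()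

    countNew-≤ : ∀ seen xs → countNew G seen xs ≤ countNew N seen xs
    countNew-≤ seen []       = ℕ.z≤n
    countNew-≤ seen (x ∷ xs) = ℕₚ.+-mono-≤ (fresh-≤ seen x) (countNew-≤ (x ∷ seen) xs)

    Agree : List (Colouring n a) → Set
    Agree L = ∀ {u v} → u ∈ L → v ∈ L → S u v ≡ true → R u v ≡ true

    agree-step : ∀ seen x → Agree seen → anyList (λ f′ → S f′ x) seen ≡ anyList (λ f′ → R f′ x) seen → Agree (x ∷ seen)
    agree-step seen x agree S-old≡R-old with anyList (λ f′ → R f′ x) seen in R-old
    ... | false = extend
      where
      S-new : ∀ {u} → u ∈ seen → S u x ≡ false
      S-new = All.lookup (anyList-false⁻ _ seen S-old≡R-old)
      extend : Agree (x ∷ seen)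
      extend (here refl) (here refl) _   = sameOrbit-refl N-group x
      extend (here refl) (there v∈)  x~v = contradiction (trans (sym (sameOrbit-sym G-group x _ x~v)) (S-new v∈)) λ ()
      extend (there u∈)  (here refl) u~x = contradiction (trans (sym u~x) (S-new u∈)) λ ()
      extend (there u∈)  (there v∈)  u~v = agree u∈ v∈ u~v
    ... | true with find (anyList⁻ _ seen R-old)
    ...   | z , z∈ , z~x = extend
      where
      R-to-x : ∀ {u} → u ∈ seen → S u x ≡ true → R u x ≡ true
      R-to-x {u} u∈ u~x = sameOrbit-trans N-group u z x
        (agree u∈ z∈ (sameOrbit-trans G-group u x z u~x (sameOrbit-sym G-group z x (N-orbit⇒G-orbit z x z~x)))) z~x
      extend : Agree (x ∷ seen)
      extend (here refl) (here refl) _   = sameOrbit-refl N-group x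
      extend (here refl) (there v∈)  x~v = sameOrbit-sym N-group _ x (R-to-x v∈ (sameOrbit-sym G-group x _ x~v))
      extend (there u∈)  (here refl) u~x = R-to-x u∈ u~x
      extend (there u∈)  (there v∈)  u~v = agree u∈ v∈ u~v

    -- Equal totals force equal terms, so each colouring is new for G exactly when it is new for N;
    -- this keeps the two orbit relations equal on the colourings seen so far.
    countNew-≡⇒agree : ∀ seen xs → countNew G seen xs ≡ countNew N seen xs → Agree seen → Agree (xs ʳ++ seen)
    countNew-≡⇒agree seen []       _  agree = agree
    countNew-≡⇒agree seen (x ∷ xs) eq agree =
      let fresh≡ , rest≡ = equal-sums-of-≤ (fresh-≤ seen x) (countNew-≤ (x ∷ seen) xs) eq
      in countNew-≡⇒agree (x ∷ seen) xs rest≡ (agree-step seen x agree (fresh-injective fresh≡))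
      where
      fresh-injective : ∀ {b c} → (if b then 0 else 1) ≡ (if c then 0 else 1) → b ≡ c
      fresh-injective {true}  {true}  _ = refl
      fresh-injective {false} {false} _ = refl

  allColourings-complete : ∀ n a (f : Colouring n a) → Any (λ f′ → ∀ i → f′ i ≡ f i) (allColourings n a)
  allColourings-complete zero    a f = here (λ ())
  allColourings-complete (suc n) a f =
    Anyₚ.concatMap⁺ (λ c → map (cons c) (allColourings n a)) (lose (∈-allFin (f zero)) (Anyₚ.map⁺
    (Any.map (λ f′≗f∘suc → λ { zero → refl ; (suc i) → f′≗f∘suc i }) (allColourings-complete n a (f ∘ suc)))))

  module _ {n a : ℕ} {G : List (Permutation′ n)} (group : IsPermGroup G) where
    open IsPermGroup group

    private
      N = evenPart G
      N-group = evenPart-isPermGroup group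

    N-orbit⇒G-orbit : ∀ (f f′ : Colouring n a) → sameOrbit N f f′ ≡ true → sameOrbit G f f′ ≡ true
    N-orbit⇒G-orbit f f′ f~f′ with find (sameOrbit⁻ N f f′ f~f′)
    ... | h , h∈N , fh≗f′ = sameOrbit⁺ G f f′ (lose (proj₁ (∈-evenPart⁻ h∈N)) fh≗f′)

    -- composing with an odd symmetry of f turns an odd h with f ∘ h = f′ into an even one
    G-orbit⇒N-orbit : (∀ f → hasOddSymmetry G f ≡ true) → ∀ (f f′ : Colouring n a) →
      sameOrbit G f f′ ≡ true → sameOrbit N f f′ ≡ true
    G-orbit⇒N-orbit odd-symmetry f f′ f~f′ with find (sameOrbit⁻ G f f′ f~f′)
    ... | h , h∈G , fh≗f′ = sameOrbit⁺ N f f′ (by-parity (isEven h) refl)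
      where
      by-parity : ∀ b → isEven h ≡ b → Any (MapsTo f f′) N
      by-parity true  h-even = evenPart⁺ (lose h∈G (fh≗f′ , h-even))
      by-parity false h-odd with find (anyList⁻ _ G (odd-symmetry f))
      ... | t , t∈G , t-odd-fixes = evenPart⁺ (Any.map
        (λ {k} k≗th → (λ i → trans (cong f (k≗th i)) (trans (t-fixes (h ⟨$⟩ʳ i)) (fh≗f′ i))) ,
                       trans (isEven-∘ t h k k≗th) (cong₂ (λ x y → not (x xor y)) t-odd h-odd))
        (closed t∈G h∈G))
        where
        t-odd = trans (sym (not-involutive (isEven t))) (cong not (∧-conicalˡ _ _ t-odd-fixes))
        t-fixes = fixes⁻ t f (∧-conicalʳ _ _ t-odd-fixes)

    orbitCount-≡ : (∀ f → hasOddSymmetry G f ≡ true) → orbitCount G a ≡ orbitCount N a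
    orbitCount-≡ odd-symmetry = CountNew.countNew-cong group N-group N-orbit⇒G-orbit
      (λ f f′ → ⇔→≡ {z = true} (mk⇔ (G-orbit⇒N-orbit odd-symmetry f f′) (N-orbit⇒G-orbit f f′)))
      [] (allColourings n a)

    orbitCount-≡⇒G-orbit⇒N-orbit : orbitCount G a ≡ orbitCount N a → ∀ (f f′ : Colouring n a) →
      sameOrbit G f f′ ≡ true → sameOrbit N f f′ ≡ true
    orbitCount-≡⇒G-orbit⇒N-orbit counts≡ f f′ f~f′
      with find (allColourings-complete n a f) | find (allColourings-complete n a f′)
    ... | c , c∈ , c≗f | c′ , c′∈ , c′≗f′ = begin
      sameOrbit N f f′  ≡⟨ sameOrbit-cong N c≗f c′≗f′ ⟨
      sameOrbit N c c′  ≡⟨ agree (∈-ʳ++⁺ˡ c∈) (∈-ʳ++⁺ˡ c′∈) (trans (sameOrbit-cong G c≗f c′≗f′) f~f′) ⟩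
      true              ∎
      where
      open ≡-Reasoning
      agree = CountNew.countNew-≡⇒agree group N-group N-orbit⇒G-orbit [] (allColourings n a) counts≡ (λ ())

    -- f ∘ t (t odd) lies in the N-orbit of f, say f ∘ t = f ∘ h with h even; then h t⁻¹ is an odd symmetry of f
    orbitCount-≡⇒hasOddSymmetry : Any (λ g → isEven g ≡ false) G → orbitCount G a ≡ orbitCount N a →
      ∀ f → hasOddSymmetry G f ≡ true
    orbitCount-≡⇒hasOddSymmetry odd counts≡ f with find odd
    ... | t , t∈G , t-odd
      with find (sameOrbit⁻ N f (f ∘ (t ⟨$⟩ʳ_))
                  (orbitCount-≡⇒G-orbit⇒N-orbit counts≡ f _ (sameOrbit⁺ G f _ (lose t∈G (λ i → refl)))))
    ...   | h , h∈N , fh≗ft with ∈-evenPart⁻ h∈N | find (inverses t∈G)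
    ...     | h∈G , h-even | u , u∈G , u≗t⁻¹ = anyList⁺ _ (Any.map
      (λ {k} k≗hu → cong₂ (λ x y → not x ∧ y)
         (trans (isEven-∘ h u k k≗hu) (cong₂ (λ x y → not (x xor y)) h-even (trans (isEven-inverse t u u≗t⁻¹) t-odd)))
         (fixes⁺ k f λ i → trans (cong f (k≗hu i)) (trans (fh≗ft (u ⟨$⟩ʳ i))
                                  (cong f (trans (cong (t ⟨$⟩ʳ_) (u≗t⁻¹ i)) (Perm.inverseʳ t))))))
      (closed h∈G u∈G))

module SignedCount where

  open CycleCount
  open OrbitCount
    using (hasOddSymmetry; hasOddSymmetry-cong; allColourings-complete; orbitCount-≡; orbitCount-≡⇒hasOddSymmetry)
  open import Data.Bool using (Bool; true; false; if_then_else_; not; _∧_)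
  open import Data.Bool.Properties using (∧-conicalˡ; ∧-conicalʳ; not-involutive)
  open import Data.Nat as ℕ using (ℕ; zero; suc)
  import Data.Nat.Properties as ℕₚ
  open import Data.Integer as ℤ using (ℤ; +_; -_; +[1+_]; -[1+_]; _+_; _*_; _^_; _≤_; _<_)
  import Data.Integer.Properties as ℤₚ
  open import Data.Fin as Fin using (Fin)
  import Data.Fin.Properties as Finₚ
  open import Relation.Nullary using (¬_; Dec; yes; no; ⌊_⌋; contradiction)
  open import Data.Fin.Permutation as Perm using (Permutation′; _⟨$⟩ʳ_; _∘ₚ_)
  open import Data.List using (List; []; _∷_; map)
  open import Data.List.Relation.Unary.Any as Any using (Any; here; there)
  open import Data.List.Relation.Unary.All as All using (All; []; _∷_)
  open import Data.List.Relation.Unary.AllPairs as AllPairs using (AllPairs; []; _∷_)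
  import Data.List.Relation.Unary.AllPairs.Properties as AllPairsₚ
  import Data.List.Relation.Unary.Any.Properties as Anyₚ
  open import Data.List.Membership.Propositional using (_∈_; find)
  open import Data.List.Membership.Propositional.Properties using (∈-map⁻)
  open import Data.Product using (_,_)
  open import Function.Bundles using (_⇔_; mk⇔)
  open import Function using (_∘_)
  open import Relation.Binary.PropositionalEquality
    using (_≡_; refl; sym; trans; cong; cong₂; subst; subst₂; module ≡-Reasoning)

  module ℤΣ where
    open ListSum ℤₚ.+-0-commutativeMonoid public

    sum-*ˡ : ∀ {A : Set} (k : ℤ) (xs : List A) (φ : A → ℤ) → k * sum xs φ ≡ sum xs (λ x → k * φ x)
    sum-*ˡ k []       φ = ℤₚ.*-zeroʳ k
    sum-*ˡ k (x ∷ xs) φ = trans (ℤₚ.*-distribˡ-+ k (φ x) _) (cong (_+_ (k * φ x)) (sum-*ˡ k xs φ))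

    sum-neg : ∀ {A : Set} (xs : List A) (φ : A → ℤ) → sum xs (λ x → - φ x) ≡ - sum xs φ
    sum-neg []       φ = refl
    sum-neg (x ∷ xs) φ = trans (cong (_+_ (- φ x)) (sum-neg xs φ)) (sym (ℤₚ.neg-distrib-+ (φ x) _))

    sum-nonneg : ∀ {A : Set} (xs : List A) {φ : A → ℤ} → All (λ x → + 0 ≤ φ x) xs → + 0 ≤ sum xs φ
    sum-nonneg []       []       = ℤₚ.≤-refl
    sum-nonneg (x ∷ xs) (p ∷ ps) = ℤₚ.+-mono-≤ p (sum-nonneg xs ps)

    sum-pos : ∀ {A : Set} {xs : List A} {φ : A → ℤ} →
      All (λ x → + 0 ≤ φ x) xs → Any (λ x → + 0 < φ x) xs → + 0 < sum xs φ
    sum-pos {xs = _ ∷ xs} (p ∷ ps) (here q)  = ℤₚ.+-mono-<-≤ q (sum-nonneg xs ps)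
    sum-pos (p ∷ ps) (there q) = ℤₚ.+-mono-≤-< p (sum-pos ps q)

    sum-zero⁻ : ∀ {A : Set} (xs : List A) {φ : A → ℤ} →
      All (λ x → + 0 ≤ φ x) xs → sum xs φ ≡ + 0 → All (λ x → φ x ≡ + 0) xs
    sum-zero⁻ []       []       _       = []
    sum-zero⁻ (x ∷ xs) {φ} (p ∷ ps) total≡0 = head≡0 ∷ sum-zero⁻ xs ps rest≡0
      where
      rest≥0 = sum-nonneg xs ps
      head≡0 : φ x ≡ + 0
      head≡0 = ℤₚ.≤-antisym (subst (φ x ≤_) total≡0
        (subst (_≤ φ x + sum xs φ) (ℤₚ.+-identityʳ (φ x)) (ℤₚ.+-monoʳ-≤ (φ x) rest≥0))) p
      rest≡0 : sum xs φ ≡ + 0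
      rest≡0 = ℤₚ.≤-antisym (subst (sum xs φ ≤_) total≡0
        (subst (_≤ φ x + sum xs φ) (ℤₚ.+-identityˡ (sum xs φ)) (ℤₚ.+-monoˡ-≤ (sum xs φ) p))) rest≥0

    sum-mono-≤ : ∀ {A : Set} (xs : List A) {φ ψ : A → ℤ} → (∀ x → φ x ≤ ψ x) → sum xs φ ≤ sum xs ψ
    sum-mono-≤ []       φ≤ψ = ℤₚ.≤-refl
    sum-mono-≤ (x ∷ xs) φ≤ψ = ℤₚ.+-mono-≤ (φ≤ψ x) (sum-mono-≤ xs φ≤ψ)

    sum-mono-< : ∀ {A : Set} (xs : List A) {φ ψ : A → ℤ} →
      (∀ x → φ x ≤ ψ x) → Any (λ x → φ x < ψ x) xs → sum xs φ < sum xs ψ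
    sum-mono-< (x ∷ xs) φ≤ψ (here q)  = ℤₚ.+-mono-<-≤ q (sum-mono-≤ xs φ≤ψ)
    sum-mono-< (x ∷ xs) φ≤ψ (there q) = ℤₚ.+-mono-≤-< (φ≤ψ x) (sum-mono-< xs φ≤ψ q)

    *-countList : ∀ {A : Set} (k : ℤ) (p : A → Bool) (xs : List A) →
      k * + countList p xs ≡ sum xs (λ x → if p x then k else + 0)
    *-countList k p []       = ℤₚ.*-zeroʳ k
    *-countList k p (x ∷ xs) = begin
      k * + (𝟙 (p x) ℕ.+ countList p xs)             ≡⟨ cong (k *_) (ℤₚ.pos-+ (𝟙 (p x)) _) ⟩
      k * (+ 𝟙 (p x) + + countList p xs)           ≡⟨ ℤₚ.*-distribˡ-+ k (+ 𝟙 (p x)) _ ⟩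
      k * + 𝟙 (p x) + k * + countList p xs       ≡⟨ cong₂ _+_ (scale (p x)) (*-countList k p xs) ⟩
      (if p x then k else + 0) + sum xs (λ y → if p y then k else + 0) ∎
      where
      open ≡-Reasoning
      scale : ∀ b → k * + 𝟙 b ≡ (if b then k else + 0)
      scale true  = ℤₚ.*-identityʳ k
      scale false = ℤₚ.*-zeroʳ k

  sgn : Bool → ℤ
  sgn b = if b then + 1 else - + 1

  sign : ∀ {n} → Permutation′ n → ℤ
  sign g = sgn (isEven g)

  pos-^ : ∀ a c → (+ a) ^ c ≡ + (a ℕ.^ c)
  pos-^ a zero    = refl
  pos-^ a (suc c) = trans (cong (+ a *_) (pos-^ a c)) (sym (ℤₚ.pos-* a (a ℕ.^ c)))

  -1^ : ∀ k → (- + 1) ^ k ≡ sgn (not (odd k))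
  -1^ zero    = refl
  -1^ (suc k) = trans (cong (- + 1 *_) (-1^ k)) (neg-sgn (not (odd k)))
    where
    neg-sgn : ∀ b → - + 1 * sgn b ≡ sgn (not b)
    neg-sgn true  = refl
    neg-sgn false = refl

  ^-distribʳ-* : ∀ x y c → (x * y) ^ c ≡ x ^ c * y ^ c
  ^-distribʳ-* x y zero    = refl
  ^-distribʳ-* x y (suc c) = trans (cong (x * y *_) (^-distribʳ-* x y c)) (interchange x y (x ^ c) (y ^ c))
    where open import Algebra.Properties.CommutativeSemigroup ℤₚ.*-commutativeSemigroup using (interchange)

  signed-term : ∀ {n} (g : Permutation′ n) (a : ℕ) → (- + 1) ^ n * (- + a) ^ cycles g ≡ sign g * + (a ℕ.^ cycles g)
  signed-term {n} g a = begin
    (- + 1) ^ n * (- + a) ^ c                   ≡⟨ cong (λ x → (- + 1) ^ n * x ^ c) (ℤₚ.-1*i≡-i (+ a)) ⟨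
    (- + 1) ^ n * (- + 1 * + a) ^ c             ≡⟨ cong ((- + 1) ^ n *_) (^-distribʳ-* (- + 1) (+ a) c) ⟩
    (- + 1) ^ n * ((- + 1) ^ c * (+ a) ^ c)     ≡⟨ ℤₚ.*-assoc ((- + 1) ^ n) _ _ ⟨
    (- + 1) ^ n * (- + 1) ^ c * (+ a) ^ c       ≡⟨ cong (_* (+ a) ^ c) (ℤₚ.^-distribˡ-+-* (- + 1) n c) ⟨
    (- + 1) ^ (n ℕ.+ c) * (+ a) ^ c             ≡⟨ cong₂ _*_ (-1^ (n ℕ.+ c)) (pos-^ a c) ⟩
    sgn (not (odd (n ℕ.+ c))) * + (a ℕ.^ c)     ≡⟨ cong (λ b → sgn b * + (a ℕ.^ c)) (isEven≡not-odd-n+cycles g) ⟨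
    sign g * + (a ℕ.^ c)                        ∎
    where
    open ≡-Reasoning
    c = cycles g

  module _ {n : ℕ} where

    _≈?_ : (g h : Permutation′ n) → Dec (g ≈ₚ h)
    g ≈? h = Finₚ.all? (λ i → g ⟨$⟩ʳ i Fin.≟ h ⟨$⟩ʳ i)

    δ : Permutation′ n → Permutation′ n → ℤ → ℤ
    δ g h v = if ⌊ g ≈? h ⌋ then v else + 0

    δ-≈ : ∀ g h v → g ≈ₚ h → δ g h v ≡ v
    δ-≈ g h v g≈h with g ≈? h
    ... | yes _   = refl
    ... | no g≉h  = contradiction g≈h g≉h

    δ-≉ : ∀ g h v → ¬ g ≈ₚ h → δ g h v ≡ + 0
    δ-≉ g h v g≉h with g ≈? h
    ... | yes g≈h = contradiction g≈h g≉h
    ... | no _    = refl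

    δ-sym : ∀ g h v → δ g h v ≡ δ h g v
    δ-sym g h v with g ≈? h | h ≈? g
    ... | yes _   | yes _   = refl
    ... | no _    | no _    = refl
    ... | yes g≈h | no h≉g  = contradiction (sym ∘ g≈h) h≉g
    ... | no g≉h  | yes h≈g = contradiction (sym ∘ h≈g) g≉h

    Distinct : List (Permutation′ n) → Set
    Distinct = AllPairs (λ g h → ¬ g ≈ₚ h)

    _∈ₚ_ : Permutation′ n → List (Permutation′ n) → Set
    g ∈ₚ hs = Any (g ≈ₚ_) hs

    Respects-≈ₚ : (Permutation′ n → ℤ) → Set
    Respects-≈ₚ φ = ∀ g h → g ≈ₚ h → φ g ≡ φ h

    sum-δ : ∀ {g hs} (ψ : Permutation′ n → ℤ) → Respects-≈ₚ ψ → Distinct hs → g ∈ₚ hs →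
      ℤΣ.sum hs (λ h → δ g h (ψ h)) ≡ ψ g
    sum-δ {g} {h ∷ hs} ψ resp (h≉hs ∷ distinct) (here g≈h) = begin
      δ g h (ψ h) + ℤΣ.sum hs (λ h′ → δ g h′ (ψ h′))  ≡⟨ cong₂ _+_ (δ-≈ g h (ψ h) g≈h) (absent hs h≉hs) ⟩
      ψ h + + 0                                       ≡⟨ ℤₚ.+-identityʳ (ψ h) ⟩
      ψ h                                             ≡⟨ resp g h g≈h ⟨
      ψ g                                             ∎
      where
      open ≡-Reasoning
      absent : ∀ hs → All (λ h′ → ¬ h ≈ₚ h′) hs → ℤΣ.sum hs (λ h′ → δ g h′ (ψ h′)) ≡ + 0
      absent []        []             = refl
      absent (h′ ∷ hs) (h≉h′ ∷ h≉hs) =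
        trans (cong₂ _+_ (δ-≉ g h′ (ψ h′) (λ g≈h′ → h≉h′ (λ i → trans (sym (g≈h i)) (g≈h′ i)))) (absent hs h≉hs))
              (ℤₚ.+-identityˡ _)
    sum-δ {g} {h ∷ hs} ψ resp (h≉hs ∷ distinct) (there g∈hs) =
      trans (cong₂ _+_ (δ-≉ g h (ψ h) (g≉h h≉hs g∈hs)) (sum-δ ψ resp distinct g∈hs)) (ℤₚ.+-identityˡ _)
      where
      g≉h : ∀ {hs} → All (λ h′ → ¬ h ≈ₚ h′) hs → g ∈ₚ hs → ¬ g ≈ₚ h
      g≉h (h≉h′ ∷ _)  (here g≈h′)  g≈h = h≉h′ (λ i → trans (sym (g≈h i)) (g≈h′ i))
      g≉h (_ ∷ h≉hs)  (there g∈hs) g≈h = g≉h h≉hs g∈hs g≈h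

    sum-same-elements : ∀ {gs hs} → Distinct gs → Distinct hs →
      (∀ {g} → g ∈ gs → g ∈ₚ hs) → (∀ {h} → h ∈ hs → h ∈ₚ gs) →
      (φ : Permutation′ n → ℤ) → Respects-≈ₚ φ → ℤΣ.sum gs φ ≡ ℤΣ.sum hs φ
    sum-same-elements {gs} {hs} distinct-gs distinct-hs gs⊆hs hs⊆gs φ resp = begin
      ℤΣ.sum gs φ
        ≡⟨ ℤΣ.sum-cong-∈ (All.tabulate λ {g} g∈gs → sym (sum-δ {g} φ resp distinct-hs (gs⊆hs g∈gs))) ⟩
      ℤΣ.sum gs (λ g → ℤΣ.sum hs (λ h → δ g h (φ h)))
        ≡⟨ ℤΣ.sum-swap gs hs (λ g h → δ g h (φ h)) ⟩
      ℤΣ.sum hs (λ h → ℤΣ.sum gs (λ g → δ g h (φ h)))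
        ≡⟨ ℤΣ.sum-cong hs (λ h → ℤΣ.sum-cong gs (λ g → δ-sym g h (φ h))) ⟩
      ℤΣ.sum hs (λ h → ℤΣ.sum gs (λ g → δ h g (φ h)))
        ≡⟨ ℤΣ.sum-cong-∈ (All.tabulate λ {h} h∈hs → sum-δ {h} (λ _ → φ h) (λ _ _ _ → refl) distinct-gs (hs⊆gs h∈hs)) ⟩
      ℤΣ.sum hs φ ∎
      where open ≡-Reasoning

  module _ {n : ℕ} {G : List (Permutation′ n)} (group : IsPermGroup G) where
    open IsPermGroup group

    sum-translate : ∀ {t} → t ∈ G → (φ : Permutation′ n → ℤ) → Respects-≈ₚ φ →
      ℤΣ.sum G φ ≡ ℤΣ.sum G (λ g → φ (g ∘ₚ t))
    sum-translate {t} t∈G φ resp =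
      trans (sum-same-elements distinct distinct-Gt G⊆Gt Gt⊆G φ resp) (ℤΣ.sum-map (_∘ₚ t) G φ)
      where
      distinct-Gt : Distinct (map (_∘ₚ t) G)
      distinct-Gt = AllPairsₚ.map⁺ (AllPairs.map (λ g≉h gt≈ht → g≉h (perm-injective t ∘ gt≈ht)) distinct)

      G⊆Gt : ∀ {g} → g ∈ G → g ∈ₚ map (_∘ₚ t) G
      G⊆Gt {g} g∈G with find (inverses t∈G)
      ... | u , u∈G , u≈t⁻¹ = Anyₚ.map⁺ (Any.map (λ k≈ug i → sym (trans (cong (t ⟨$⟩ʳ_) (trans (k≈ug i) (u≈t⁻¹ _)))
                                                                           (Perm.inverseʳ t)))
                                                  (closed u∈G g∈G))

      Gt⊆G : ∀ {h} → h ∈ map (_∘ₚ t) G → h ∈ₚ G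
      Gt⊆G h∈Gt with ∈-map⁻ (_∘ₚ t) h∈Gt
      ... | g , g∈G , refl = Any.map (λ k≈tg i → sym (k≈tg i)) (closed t∈G g∈G)

    module _ {a : ℕ} (f : Colouring n a) where

      signIfFixes : Permutation′ n → ℤ
      signIfFixes g = if fixes g f then sign g else + 0

      signedStabiliser : ℤ
      signedStabiliser = ℤΣ.sum G signIfFixes

      signIfFixes-resp : Respects-≈ₚ signIfFixes
      signIfFixes-resp g h g≈h = cong₂ (λ fix even → if fix then sgn even else + 0)
        (allFin?-cong {n} λ i → cong (λ x → ⌊ f x Fin.≟ f i ⌋) (g≈h i)) (isEven-cong {g = g} {h} g≈h)

      signedStabiliser-odd : hasOddSymmetry G f ≡ true → signedStabiliser ≡ + 0
      signedStabiliser-odd odd-fixes with find (anyList⁻ (λ g → not (isEven g) ∧ fixes g f) G odd-fixes)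
      ... | t , t∈G , t-odd-fixes = x≡-x⇒x≡0 (begin
        ℤΣ.sum G signIfFixes                       ≡⟨ sum-translate t∈G signIfFixes signIfFixes-resp ⟩
        ℤΣ.sum G (λ g → signIfFixes (g ∘ₚ t))      ≡⟨ ℤΣ.sum-cong G translate-negates ⟩
        ℤΣ.sum G (λ g → - signIfFixes g)           ≡⟨ ℤΣ.sum-neg G signIfFixes ⟩
        - ℤΣ.sum G signIfFixes                     ∎)
        where
        open ≡-Reasoning
        t-odd : isEven t ≡ false
        t-odd = trans (sym (not-involutive (isEven t))) (cong not (∧-conicalˡ _ _ t-odd-fixes))
        t-fixes : ∀ i → f (t ⟨$⟩ʳ i) ≡ f i
        t-fixes = fixes⁻ t f (∧-conicalʳ _ _ t-odd-fixes)
        translate-negates : ∀ g → signIfFixes (g ∘ₚ t) ≡ - signIfFixes g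
        translate-negates g rewrite allFin?-cong {p = λ i → ⌊ f (t ⟨$⟩ʳ (g ⟨$⟩ʳ i)) Fin.≟ f i ⌋}
                                    (λ i → cong (λ x → ⌊ x Fin.≟ f i ⌋) (t-fixes (g ⟨$⟩ʳ i)))
                     | isEven-∘ t g (g ∘ₚ t) (λ _ → refl) | t-odd
          with fixes g f | isEven g
        ... | false | _     = refl
        ... | true  | true  = refl
        ... | true  | false = refl
        x≡-x⇒x≡0 : ∀ {x} → x ≡ - x → x ≡ + 0
        x≡-x⇒x≡0 {+ zero}    _  = refl
        x≡-x⇒x≡0 {+[1+ _ ]}  ()
        x≡-x⇒x≡0 { -[1+ _ ]} ()

      signIfFixes-nonneg : ∀ g → (not (isEven g) ∧ fixes g f) ≡ false → + 0 ≤ signIfFixes g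
      signIfFixes-nonneg g not-odd-fixes with fixes g f | isEven g
      ... | false | _     = ℤₚ.≤-refl
      ... | true  | true  = ℤ.+≤+ ℕ.z≤n

      signedStabiliser-pos : hasOddSymmetry G f ≡ false → + 0 < signedStabiliser
      signedStabiliser-pos no-odd = ℤΣ.sum-pos
        (All.map (λ {g} → signIfFixes-nonneg g) (anyList-false⁻ (λ g → not (isEven g) ∧ fixes g f) G no-odd))
        (Any.map (λ {e} → identity-term {e}) hasId)
        where
        identity-term : ∀ {e} → (∀ i → e ⟨$⟩ʳ i ≡ i) → + 0 < signIfFixes e
        identity-term {e} e≗id rewrite fixes⁺ e f (cong f ∘ e≗id) | isEven-identity e e≗id = ℤ.+<+ (ℕ.s≤s ℕ.z≤n)

      signedStabiliser-nonneg : + 0 ≤ signedStabiliser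
      signedStabiliser-nonneg with hasOddSymmetry G f in odd
      ... | true  = ℤₚ.≤-reflexive (sym (signedStabiliser-odd odd))
      ... | false = ℤₚ.<⇒≤ (signedStabiliser-pos odd)

    signedCycleIndex≡sum-signedStabiliser : ∀ a →
      (- + 1) ^ n * cycleIndexPoly G (- + a) ≡ ℤΣ.sum (allColourings n a) signedStabiliser
    signedCycleIndex≡sum-signedStabiliser a = begin
      (- + 1) ^ n * ℤΣ.sum G (λ g → (- + a) ^ cycles g)
        ≡⟨ ℤΣ.sum-*ˡ ((- + 1) ^ n) G (λ g → (- + a) ^ cycles g) ⟩
      ℤΣ.sum G (λ g → (- + 1) ^ n * (- + a) ^ cycles g)
        ≡⟨ ℤΣ.sum-cong G (λ g → trans (signed-term g a) (cong (λ k → sign g * + k) (sym (fixedColourings≡^cycles a g)))) ⟩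
      ℤΣ.sum G (λ g → sign g * + fixedColourings a g)
        ≡⟨ ℤΣ.sum-cong G (λ g → ℤΣ.*-countList (sign g) (fixes g) (allColourings n a)) ⟩
      ℤΣ.sum G (λ g → ℤΣ.sum (allColourings n a) (λ f → signIfFixes f g))
        ≡⟨ ℤΣ.sum-swap G (allColourings n a) (λ g f → signIfFixes f g) ⟩
      ℤΣ.sum (allColourings n a) signedStabiliser ∎
      where open ≡-Reasoning

    signedCycleIndex<cycleIndex : Any (λ g → isEven g ≡ false) G → ∀ {a} → 1 ℕ.≤ a →
      (- + 1) ^ n * cycleIndexPoly G (- + a) < cycleIndexPoly G (+ a)
    signedCycleIndex<cycleIndex odd {a} 1≤a = subst₂ _<_
      (sym (trans (ℤΣ.sum-*ˡ ((- + 1) ^ n) G (λ g → (- + a) ^ cycles g)) (ℤΣ.sum-cong G (λ g → signed-term g a))))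
      (sym (ℤΣ.sum-cong G (λ g → pos-^ a (cycles g))))
      (ℤΣ.sum-mono-< G (λ g → sign≤1 (isEven g) _) (Any.map odd-term odd))
      where
      sign≤1 : ∀ b x → sgn b * + x ≤ + x
      sign≤1 true  x = ℤₚ.≤-reflexive (ℤₚ.*-identityˡ (+ x))
      sign≤1 false x = subst (_≤ + x) (sym (ℤₚ.-1*i≡-i (+ x))) ℤₚ.neg-≤-pos
      odd-term : ∀ {g : Permutation′ n} → isEven g ≡ false → sign g * + (a ℕ.^ cycles g) < + (a ℕ.^ cycles g)
      odd-term {g} g-odd rewrite g-odd with a ℕ.^ cycles g | ℕₚ.m^n>0 a {{ℕ.>-nonZero 1≤a}} (cycles g)
      ... | suc _ | _ = ℤ.-<+

    signedCycleIndex-nonneg : ∀ a → + 0 ≤ (- + 1) ^ n * cycleIndexPoly G (- + a)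
    signedCycleIndex-nonneg a = subst (+ 0 ≤_) (sym (signedCycleIndex≡sum-signedStabiliser a))
      (ℤΣ.sum-nonneg (allColourings n a) (All.tabulate λ {f} _ → signedStabiliser-nonneg f))

    signedCycleIndex≡0⇔orbitCount≡ : Any (λ g → isEven g ≡ false) G → ∀ a →
      ((- + 1) ^ n * cycleIndexPoly G (- + a) ≡ + 0) ⇔ (orbitCount G a ≡ orbitCount (evenPart G) a)
    signedCycleIndex≡0⇔orbitCount≡ odd a = mk⇔ to from
      where
      sum≡s = signedCycleIndex≡sum-signedStabiliser a

      to : (- + 1) ^ n * cycleIndexPoly G (- + a) ≡ + 0 → orbitCount G a ≡ orbitCount (evenPart G) a
      to s≡0 = orbitCount-≡ group every-f
        where
        all-zero = ℤΣ.sum-zero⁻ (allColourings n a) (All.tabulate λ {f} _ → signedStabiliser-nonneg f) (trans (sym sum≡s) s≡0)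
        listed : ∀ {f} → signedStabiliser f ≡ + 0 → hasOddSymmetry G f ≡ true
        listed {f} stab≡0 with hasOddSymmetry G f in odd-f
        ... | true  = refl
        ... | false = contradiction (sym stab≡0) (ℤₚ.<⇒≢ (signedStabiliser-pos f odd-f))
        every-f : ∀ f → hasOddSymmetry G f ≡ true
        every-f f with find (allColourings-complete n a f)
        ... | f′ , f′∈ , f′≗f = trans (sym (hasOddSymmetry-cong G f′≗f)) (listed (All.lookup all-zero f′∈))

      from : orbitCount G a ≡ orbitCount (evenPart G) a → (- + 1) ^ n * cycleIndexPoly G (- + a) ≡ + 0
      from counts≡ = trans sum≡s (trans
        (ℤΣ.sum-cong (allColourings n a) λ f → signedStabiliser-odd f (orbitCount-≡⇒hasOddSymmetry group odd counts≡ f))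
        (ℤΣ.sum-ε (allColourings n a)))

open import Data.Nat using (ℕ; _≤_)
open import Data.Bool using (false)
open import Data.Fin.Permutation using (Permutation′)
open import Data.List using (List)
open import Data.List.Relation.Unary.Any using (Any)
open import Data.Integer as ℤ using (ℤ; +_; -_; _*_; _^_)
open import Data.Product using (_×_; _,_)
open import Function.Bundles using (_⇔_)
open import Relation.Binary.PropositionalEquality using (_≡_)

open SignedCount using (signedCycleIndex-nonneg; signedCycleIndex<cycleIndex; signedCycleIndex≡0⇔orbitCount≡)

mainTheorem3 : (n : ℕ) (G : List (Permutation′ n)) → IsPermGroup G →
    Any (λ g → isEven g ≡ false) G →
    (a : ℕ) → 1 ≤ a →
    let s = (- + 1) ^ n * cycleIndexPoly G (- + a) in
    (+ 0 ℤ.≤ s) × (s ℤ.< cycleIndexPoly G (+ a)) ×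
    ((s ≡ + 0) ⇔ (orbitCount G a ≡ orbitCount (evenPart G) a))
mainTheorem3 n G group odd a 1≤a =
  signedCycleIndex-nonneg group a ,
  signedCycleIndex<cycleIndex group odd 1≤a ,
  signedCycleIndex≡0⇔orbitCount≡ group odd a
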